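{- Let $G$ be a finite group such that $\Gamma(G)$ is a cograph. Then: (1) every nonidentity element of $G$ has order either a prime or a power of $2$; (2) for every odd prime $p$ dividing $|G|$, a Sylow $p$-subgroup of $G$ has exponent $p$; (3) if a Sylow $2$-subgroup $H$ of $G$ is non-cyclic and abelian, then $H$ has exponent at most $4$; (4) no two elements of distinct prime orders commute; (5) if $G$ is not a $p$-group for any prime $p$, then the center $Z(G)$ is trivial.
   Context: For a finite group $G$, the prime-order element graph $\Gamma(G)$ is the simple graph with vertex set $G$ in which two distinct vertices $x,y$ are adjacent if and only if the order of $xy$ is a prime. A cograph is a graph with no induced path on four vertices. -}

module Defs where

open import Level using (0ℓ)
open import Data.Nat using (ℕ; zero; suc; _<_; _≤_; _^_)
open import Data.Nat.Divisibility using (_∣_)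
open import Data.Fin using (Fin)
open import Data.Fin.Subset using (Subset; _∈_; ∣_∣)
open import Data.Product using (Σ; ∃; ∃-syntax; _×_; _,_)
open import Relation.Nullary using (¬_)
open import Relation.Binary.PropositionalEquality using (_≡_; _≢_)
open import Algebra.Structures using (IsGroup)
open import Data.Nat.Primality using (Prime)

-- A finite group of order n, presented (up to isomorphism) on the carrier Fin n
-- with propositional equality; the group axioms are the library's IsGroup.
record FinGroup : Set where
  field
    n     : ℕ
    _∙_   : Fin n → Fin n → Fin n
    ε     : Fin n
    _⁻¹   : Fin n → Fin n
    isGroup : IsGroup _≡_ _∙_ ε _⁻¹
  infixl 7 _∙_

  order : ℕ
  order = n

  pow : Fin n → ℕ → Fin n
  pow x zero    = ε
  pow x (suc k) = x ∙ pow x k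

  HasOrder : Fin n → ℕ → Set
  HasOrder x k = 0 < k × pow x k ≡ ε × (∀ j → 0 < j → j < k → pow x j ≢ ε)

  Adj : Fin n → Fin n → Set
  Adj x y = x ≢ y × ∃[ p ] (Prime p × HasOrder (x ∙ y) p)

  InducedP4 : Fin n → Fin n → Fin n → Fin n → Set
  InducedP4 a b c d =
    (a ≢ b × a ≢ c × a ≢ d × b ≢ c × b ≢ d × c ≢ d) ×
    (Adj a b × Adj b c × Adj c d) ×
    (¬ Adj a c × ¬ Adj a d × ¬ Adj b d)

  IsCograph : Set
  IsCograph = ∀ a b c d → ¬ InducedP4 a b c d

  IsSubgroup : Subset n → Set
  IsSubgroup H = ε ∈ H × (∀ x y → x ∈ H → y ∈ H → (x ∙ y) ∈ H) × (∀ x → x ∈ H → (x ⁻¹) ∈ H)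

  IsSylow : ℕ → Subset n → Set
  IsSylow p H = IsSubgroup H × ∃[ a ] (∣ H ∣ ≡ p ^ a × p ^ a ∣ n × ¬ (p ^ suc a ∣ n))

  HasExponent : Subset n → ℕ → Set
  HasExponent H e = 0 < e × (∀ h → h ∈ H → pow h e ≡ ε)
                    × (∀ j → 0 < j → j < e → ¬ (∀ h → h ∈ H → pow h j ≡ ε))

  IsCyclic : Subset n → Set
  IsCyclic H = ∃[ g ] (g ∈ H × (∀ h → h ∈ H → ∃[ k ] h ≡ pow g k))

  IsAbelian : Subset n → Set
  IsAbelian H = ∀ x y → x ∈ H → y ∈ H → x ∙ y ≡ y ∙ x

  IsPrimePowerGroup : Set
  IsPrimePowerGroup = ∃[ p ] (Prime p × ∃[ a ] n ≡ p ^ a)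

  TrivialCenter : Set
  TrivialCenter = ∀ z → (∀ g → z ∙ g ≡ g ∙ z) → z ≡ ε

-- Every item is proved by contradiction, by exhibiting an induced path on four vertices in Γ(G)
-- in one of three configurations: commuting elements of distinct prime orders, an element of
-- order p² for an odd prime p, and an element of order 8 with a commuting involution outside
-- the subgroup it generates.  The first gives (4), and (5) with Cauchy's theorem; together with
-- the second it shows that an odd prime dividing the order of an element is that order, giving
-- (1), and (2) with Lagrange's theorem.  For (3), take g of maximal order 2^m ≥ 8 in H and
-- y ∈ H outside ⟨g⟩; some power w = y^(2^i) outside ⟨g⟩ has w² = gᵗ, with t even by the
-- maximality of ord g, so w g^(-t/2) is an involution outside ⟨g⟩ and the third configuration
-- appears with g^(2^(m-3)).  Lagrange and Cauchy (in McKay's form) are both orbit counts for a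
-- permutation whose non-fixed points all have the same period.

module Submission where

open import Defs
open import Data.Nat using (_≤_; _^_)
open import Data.Nat.Divisibility using (_∣_)
open import Data.Nat.Primality using (Prime)
open import Data.Product using (∃-syntax; _×_; _,_)
open import Data.Sum using (_⊎_)
open import Relation.Nullary using (¬_)
open import Relation.Binary.PropositionalEquality using (_≡_; _≢_)

module Arithmetic where

  open import Data.Empty
  open import Data.List using ([]; _∷_)
  open import Data.List.Relation.Unary.All using (_∷_)
  open import Data.Nat
  open import Data.Nat.DivMod
  open import Data.Nat.Divisibility
  open import Data.Nat.Induction using (<-wellFounded)
  open import Data.Nat.ListAction using (product)
  open import Data.Nat.Primality
  open import Data.Nat.Primality.Factorisation using (factorise)
  open import Data.Nat.Properties
  open import Data.Nat.Tactic.RingSolver using (solve-∀)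
  open import Data.Product
  open import Data.Sum
  open import Function using (id; _⇔_; Equivalence)
  open import Induction.WellFounded using (Acc; acc)
  open import Relation.Binary.Definitions using (tri<; tri≈; tri>)
  open import Relation.Binary.PropositionalEquality
  open import Relation.Nullary
  open import Relation.Nullary.Decidable using (_×-dec_)
  open import Relation.Unary using (Decidable)

  prime⇒>1 : ∀ {p} → Prime p → 1 < p
  prime⇒>1 {p} pp = nonTrivial⇒n>1 p {{prime⇒nonTrivial pp}}

  prime⇒>0 : ∀ {p} → Prime p → 0 < p
  prime⇒>0 pp = <-trans z<s (prime⇒>1 pp)

  prime∤1 : ∀ {p} → Prime p → ¬ p ∣ 1
  prime∤1 pp p∣1 = <-irrefl (sym (∣1⇒≡1 p∣1)) (prime⇒>1 pp)

  prime∣prime⇒≡ : ∀ {p q} → Prime p → Prime q → p ∣ q → p ≡ q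
  prime∣prime⇒≡ pp pq p∣q with prime⇒irreducible pq p∣q
  ... | inj₁ refl = ⊥-elim (prime∤1 pp ∣-refl)
  ... | inj₂ p≡q = p≡q

  prime∣^⇒∣ : ∀ {r p} a → Prime r → r ∣ p ^ a → r ∣ p
  prime∣^⇒∣ zero    pr r∣1 = ⊥-elim (prime∤1 pr r∣1)
  prime∣^⇒∣ {p = p} (suc a) pr r∣p^suc = [ id , prime∣^⇒∣ a pr ]′ (euclidsLemma p (p ^ a) pr r∣p^suc)

  ∃-primeDivisor : ∀ n → 1 < n → ∃ λ p → Prime p × p ∣ n
  ∃-primeDivisor n@(suc _) 1<n with factorise n
  ... | record { factors = [] ; isFactorisation = n≡1 } = ⊥-elim (<-irrefl (sym n≡1) 1<n)
  ... | record { factors = p ∷ ps ; isFactorisation = n≡ ; factorsPrime = pp ∷ _ } =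
        p , pp , divides (product ps) (trans n≡ (*-comm p (product ps)))

  p-adicDecomposition : ∀ {p} → 1 < p → ∀ n → 0 < n → ∃₂ λ a r → n ≡ p ^ a * r × ¬ p ∣ r
  p-adicDecomposition {p} 1<p n 0<n = go n 0<n (<-wellFounded n)
    where
    go : ∀ n → 0 < n → Acc _<_ n → ∃₂ λ a r → n ≡ p ^ a * r × ¬ p ∣ r
    go n 0<n (acc rec) with p ∣? n
    ... | no p∤n = 0 , n , sym (+-identityʳ n) , p∤n
    ... | yes (divides c n≡c*p) with go c 0<c (rec c<n)
      where
      0<c : 0 < c
      0<c = n≢0⇒n>0 λ { refl → <-irrefl (sym n≡c*p) 0<n }
      c<n : c < n
      c<n = subst (c <_) (sym n≡c*p) (m<m*n c p {{>-nonZero 0<c}} 1<p)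
    ...   | a , r , c≡ , p∤r = suc a , r , n≡ , p∤r
      where
      open ≡-Reasoning
      n≡ : n ≡ p ^ suc a * r
      n≡ = begin
        n               ≡⟨ n≡c*p ⟩
        c * p           ≡⟨ cong (_* p) c≡ ⟩
        p ^ a * r * p   ≡⟨ *-comm (p ^ a * r) p ⟩
        p * (p ^ a * r) ≡⟨ *-assoc p (p ^ a) r ⟨
        p ^ suc a * r   ∎

  ∣p^a⇒≡p^b : ∀ {p d} a → Prime p → d ∣ p ^ a → ∃ λ b → d ≡ p ^ b
  ∣p^a⇒≡p^b {p} {d} a pp d∣p^a with p-adicDecomposition (prime⇒>1 pp) d 0<d
    where
    0<d : 0 < d
    0<d = n≢0⇒n>0 λ { refl → ≢-nonZero⁻¹ (p ^ a) {{m^n≢0 p a {{prime⇒nonZero pp}}}} (0∣⇒≡0 d∣p^a) }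
  ... | b , zero , d≡ , p∤r = ⊥-elim (p∤r (p ∣0))
  ... | b , suc zero , d≡ , _ = b , trans d≡ (*-identityʳ (p ^ b))
  ... | b , r@(suc (suc _)) , d≡ , p∤r with ∃-primeDivisor r (s≤s (s≤s z≤n))
  ...   | s , ps , s∣r = ⊥-elim (p∤r (subst (_∣ r) s≡p s∣r))
    where
    s∣p^a : s ∣ p ^ a
    s∣p^a = ∣-trans (∣-trans s∣r (subst (r ∣_) (sym d≡) (n∣m*n (p ^ b)))) d∣p^a
    s≡p : s ≡ p
    s≡p = prime∣prime⇒≡ ps pp (prime∣^⇒∣ a ps s∣p^a)

  ∃-otherPrimeDivisor : ∀ {p n} → Prime p → 0 < n → (∀ a → n ≢ p ^ a) → ∃ λ s → Prime s × s ≢ p × s ∣ n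
  ∃-otherPrimeDivisor {p} {n} pp 0<n n≢p^a with p-adicDecomposition (prime⇒>1 pp) n 0<n
  ... | a , zero          , _   , p∤r = ⊥-elim (p∤r (p ∣0))
  ... | a , suc zero      , n≡  , _   = ⊥-elim (n≢p^a a (trans n≡ (*-identityʳ (p ^ a))))
  ... | a , r@(suc (suc _)) , n≡ , p∤r with ∃-primeDivisor r (s≤s (s≤s z≤n))
  ...   | s , ps , s∣r = s , ps , (λ { refl → p∤r s∣r }) , subst (s ∣_) (sym n≡) (∣n⇒∣m*n (p ^ a) s∣r)

  p^a≤p^b⇒a≤b : ∀ {p} a b → 1 < p → p ^ a ≤ p ^ b → a ≤ b
  p^a≤p^b⇒a≤b {p} a b 1<p p^a≤p^b = ≮⇒≥ λ b<a → <⇒≱ (^-monoʳ-< p 1<p b<a) p^a≤p^b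

  p^a≤p^b⇒p^a∣p^b : ∀ {p} a b → 1 < p → p ^ a ≤ p ^ b → p ^ a ∣ p ^ b
  p^a≤p^b⇒p^a∣p^b {p} a b 1<p p^a≤p^b = divides (p ^ (b ∸ a)) (begin
      p ^ b               ≡⟨ cong (p ^_) (m+[n∸m]≡n a≤b) ⟨
      p ^ (a + (b ∸ a))   ≡⟨ ^-distribˡ-+-* p a (b ∸ a) ⟩
      p ^ a * p ^ (b ∸ a) ≡⟨ *-comm (p ^ a) _ ⟩
      p ^ (b ∸ a) * p ^ a ∎)
    where
    open ≡-Reasoning
    a≤b : a ≤ b
    a≤b = p^a≤p^b⇒a≤b a b 1<p p^a≤p^b

  -- In Defs, HasOrder x k is by definition LeastPositive (λ j → pow x j ≡ ε) k.
  LeastPositive : (ℕ → Set) → ℕ → Set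
  LeastPositive P k = 0 < k × P k × (∀ j → 0 < j → j < k → ¬ P j)

  least : ∀ {P : ℕ → Set} → Decidable P → ∀ {m} → P m → ∃ λ k → P k × (∀ j → j < k → ¬ P j)
  least {P} P? {m} Pm = [ (λ none → ⊥-elim (none m ≤-refl Pm)) , (λ found → found) ]′ (search (suc m))
    where
    search : ∀ m → (∀ j → j < m → ¬ P j) ⊎ ∃ λ k → P k × (∀ j → j < k → ¬ P j)
    search zero = inj₁ λ _ ()
    search (suc m) with search m | P? m
    ... | inj₂ found | _      = inj₂ found
    ... | inj₁ none  | yes Pm = inj₂ (m , Pm , none)
    ... | inj₁ none  | no ¬Pm = inj₁ λ j j<1+m → [ none j , (λ { refl → ¬Pm }) ]′ (m≤n⇒m<n∨m≡n (≤-pred j<1+m))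

  leastPositive : ∀ {P : ℕ → Set} → Decidable P → ∀ {m} → 0 < m → P m → ∃ (LeastPositive P)
  leastPositive P? 0<m Pm with least (λ j → (0 <? j) ×-dec P? j) (0<m , Pm)
  ... | k , (0<k , Pk) , below = k , 0<k , Pk , λ j 0<j j<k Pj → below j j<k (0<j , Pj)

  leastPositive-unique : ∀ {P : ℕ → Set} {k l} → LeastPositive P k → LeastPositive P l → k ≡ l
  leastPositive-unique (0<k , Pk , below-k) (0<l , Pl , below-l) with <-cmp _ _
  ... | tri< k<l _ _ = ⊥-elim (below-l _ 0<k k<l Pk)
  ... | tri≈ _ k≡l _ = k≡l
  ... | tri> _ _ l<k = ⊥-elim (below-k _ 0<l l<k Pl)

  leastPositive-∣ : ∀ {P : ℕ → Set} {k} → LeastPositive P k → (∀ q r → P (r + q * k) → P r) →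
                    ∀ {m} → P m → k ∣ m
  leastPositive-∣ {P} {k} (0<k , _ , below) reduce {m} Pm = m%n≡0⇒n∣m m k (remainder≡0 (m % k) refl)
    where
    instance
      k≢0 : NonZero k
      k≢0 = >-nonZero 0<k
    P[m%k] : P (m % k)
    P[m%k] = reduce (m / k) (m % k) (subst P (m≡m%n+[m/n]*n m k) Pm)
    remainder≡0 : ∀ r → r ≡ m % k → r ≡ 0
    remainder≡0 zero    _ = refl
    remainder≡0 (suc r) eq = ⊥-elim (below (suc r) z<s (subst (_< k) (sym eq) (m%n<n m k)) (subst P (sym eq) P[m%k]))

  leastPositive-⇔ : ∀ {P Q : ℕ → Set} {k} → (∀ j → P j ⇔ Q j) → LeastPositive P k → LeastPositive Q k
  leastPositive-⇔ P⇔Q (0<k , Pk , below) =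
    0<k , Equivalence.to (P⇔Q _) Pk , λ j 0<j j<k Qj → below j 0<j j<k (Equivalence.from (P⇔Q j) Qj)

  upcrossing : ∀ {P : ℕ → Set} → Decidable P → ∀ {s} → ¬ P 0 → P s → ∃ λ i → ¬ P i × P (suc i)
  upcrossing P? {zero}  ¬P0 P0  = ⊥-elim (¬P0 P0)
  upcrossing P? {suc s} ¬P0 Ps+1 with P? s
  ... | yes Ps = upcrossing P? ¬P0 Ps
  ... | no ¬Ps = s , ¬Ps , Ps+1

  m*n*n≡n*n*m : ∀ m n → m * n * n ≡ n * n * m
  m*n*n≡n*n*m = solve-∀

  m*n*o≡n*[m*o] : ∀ m n o → m * n * o ≡ n * (m * o)
  m*n*o≡n*[m*o] = solve-∀

  2*[2*[2*m]]≡8*m : ∀ m → 2 * (2 * (2 * m)) ≡ 8 * m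
  2*[2*[2*m]]≡8*m = solve-∀

  m*2+2*[m*n]≡2*[m*n+m] : ∀ m n → m * 2 + 2 * (m * n) ≡ 2 * (m * n + m)
  m*2+2*[m*n]≡2*[m*n+m] = solve-∀

  [2+m]+[4+m]≡2*[3+m] : ∀ m → (2 + m) + (4 + m) ≡ 2 * (3 + m)
  [2+m]+[4+m]≡2*[3+m] = solve-∀

  [4+m]+[8+6m+m²]≡[4+m]*[3+m] : ∀ m → (4 + m) + (8 + 6 * m + m * m) ≡ (4 + m) * (3 + m)
  [4+m]+[8+6m+m²]≡[4+m]*[3+m] = solve-∀

  1+[8+6m+m²]≡[3+m]*[3+m] : ∀ m → 1 + (8 + 6 * m + m * m) ≡ (3 + m) * (3 + m)
  1+[8+6m+m²]≡[3+m]*[3+m] = solve-∀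

  [2+m]+[8+6m+m²]+2≡[4+m]*[3+m] : ∀ m → (2 + m) + (8 + 6 * m + m * m) + 2 ≡ (4 + m) * (3 + m)
  [2+m]+[8+6m+m²]+2≡[4+m]*[3+m] = solve-∀

  8+6m+m²≡[4+m]+[4+5m+m²] : ∀ m → 8 + 6 * m + m * m ≡ (4 + m) + (4 + 5 * m + m * m)
  8+6m+m²≡[4+m]+[4+5m+m²] = solve-∀

module Counting where

  open import Data.Bool using (true; false; if_then_else_)
  open import Data.Empty
  open import Data.List using (List; []; _∷_; length)
  open import Data.List.Membership.Propositional using (_∈_; _∉_)
  open import Data.List.Relation.Unary.All as All using (All; []; _∷_)
  open import Data.List.Relation.Unary.All.Properties using (All¬⇒¬Any)
  open import Data.List.Relation.Unary.Any using (here; there)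
  open import Data.List.Relation.Unary.Unique.Propositional using (Unique; []; _∷_)
  open import Data.Nat
  open import Data.Nat.Properties
  open import Data.Product
  open import Function using (_∘_; _⇔_; mk⇔)
  open import Level using (0ℓ)
  open import Relation.Binary.Definitions using (DecidableEquality)
  open import Relation.Binary.PropositionalEquality
  open import Relation.Nullary
  open import Relation.Nullary.Decidable using (does-⇔; dec-true; dec-false; _×-dec_; ¬?)
  open import Relation.Unary using (Pred; Decidable)

  module _ {A : Set} where

    count : ∀ {P : Pred A 0ℓ} → Decidable P → List A → ℕ
    count P? []       = 0
    count P? (x ∷ xs) = if does (P? x) then suc (count P? xs) else count P? xs

    module _ {P Q : Pred A 0ℓ} (P? : Decidable P) (Q? : Decidable Q) where

      count-cong : ∀ {xs} → All (λ b → P b ⇔ Q b) xs → count P? xs ≡ count Q? xs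
      count-cong {[]}     []         = refl
      count-cong {x ∷ xs} (Px⇔Qx ∷ eqs) rewrite does-⇔ Px⇔Qx (P? x) (Q? x) | count-cong eqs = refl

      count-mono : (∀ {b} → P b → Q b) → ∀ xs → count P? xs ≤ count Q? xs
      count-mono P⇒Q []       = z≤n
      count-mono P⇒Q (x ∷ xs) with P? x | Q? x
      ... | yes _  | yes _   = s≤s (count-mono P⇒Q xs)
      ... | yes Px | no ¬Qx  = ⊥-elim (¬Qx (P⇒Q Px))
      ... | no _   | yes _   = m≤n⇒m≤1+n (count-mono P⇒Q xs)
      ... | no _   | no _    = count-mono P⇒Q xs

    module _ {P : Pred A 0ℓ} (P? : Decidable P) where

      count-none : (∀ b → ¬ P b) → ∀ xs → count P? xs ≡ 0
      count-none ¬P []       = refl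
      count-none ¬P (x ∷ xs) rewrite dec-false (P? x) (¬P x) = count-none ¬P xs

      count-all : (∀ b → P b) → ∀ xs → count P? xs ≡ length xs
      count-all allP []       = refl
      count-all allP (x ∷ xs) rewrite dec-true (P? x) (allP x) = cong suc (count-all allP xs)

      count>0⇒∃ : ∀ xs → 0 < count P? xs → ∃ P
      count>0⇒∃ (x ∷ xs) 0<count with P? x
      ... | yes Px = x , Px
      ... | no _   = count>0⇒∃ xs 0<count

  module Removal {A : Set} (_≟_ : DecidableEquality A) where

    open import Data.List.Membership.DecPropositional _≟_ using (_∈?_)

    infixl 6 _-?_ _─?_

    _-?_ : ∀ {P : Pred A 0ℓ} → Decidable P → (a : A) → Decidable (λ b → P b × b ≢ a)
    (P? -? a) b = P? b ×-dec ¬? (b ≟ a)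

    _─?_ : ∀ {P : Pred A 0ℓ} → Decidable P → (os : List A) → Decidable (λ b → P b × b ∉ os)
    (P? ─? os) b = P? b ×-dec ¬? (b ∈? os)

    count-remove : ∀ {P : Pred A 0ℓ} (P? : Decidable P) {a xs} → Unique xs → a ∈ xs → P a →
                   count P? xs ≡ suc (count (P? -? a) xs)
    count-remove P? {a} (a∉xs ∷ _) (here refl) Pa
      rewrite dec-false ((P? -? a) a) (λ (_ , a≢a) → a≢a refl) | dec-true (P? a) Pa =
      cong suc (count-cong P? (P? -? a) (All.map (λ a≢b → mk⇔ (λ Pb → Pb , a≢b ∘ sym) proj₁) a∉xs))
    count-remove P? {a} {x ∷ xs} (x∉xs ∷ u) (there a∈xs) Pa
      rewrite does-⇔ (mk⇔ proj₁ (λ Px → Px , All.lookup x∉xs a∈xs)) ((P? -? a) x) (P? x)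
            | count-remove P? u a∈xs Pa with does (P? x)
    ... | true  = refl
    ... | false = refl

    count-removeAll : ∀ {P : Pred A 0ℓ} (P? : Decidable P) {os xs} → Unique xs → All (_∈ xs) os → Unique os →
                      All P os → count P? xs ≡ length os + count (P? ─? os) xs
    count-removeAll P? {[]} {xs} _ _ _ _ = count-cong P? (P? ─? []) {xs} (All.tabulate λ _ → mk⇔ (λ Pb → Pb , λ ()) proj₁)
    count-removeAll {P} P? {o ∷ os} {xs} u-xs (o∈xs ∷ os⊆xs) (o∉os ∷ u-os) (Po ∷ Pos) = begin
      count P? xs                                   ≡⟨ count-removeAll P? u-xs os⊆xs u-os Pos ⟩
      length os + count (P? ─? os) xs               ≡⟨ cong (length os +_) remove-o ⟩
      length os + suc (count ((P? ─? os) -? o) xs)  ≡⟨ +-suc (length os) _ ⟩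
      suc (length os + count ((P? ─? os) -? o) xs)  ≡⟨ cong (λ c → suc (length os + c)) merge ⟩
      suc (length os + count (P? ─? (o ∷ os)) xs)   ∎
      where
      open ≡-Reasoning
      remove-o : count (P? ─? os) xs ≡ suc (count ((P? ─? os) -? o) xs)
      remove-o = count-remove (P? ─? os) u-xs o∈xs (Po , All¬⇒¬Any o∉os)
      ─∷⇔ : ∀ {b} → ((P b × b ∉ os) × b ≢ o) ⇔ (P b × b ∉ o ∷ os)
      ─∷⇔ = mk⇔ (λ ((Pb , b∉os) , b≢o) → Pb , λ { (here b≡o) → b≢o b≡o ; (there b∈os) → b∉os b∈os })
                (λ (Pb , b∉o∷os) → (Pb , b∉o∷os ∘ there) , b∉o∷os ∘ here)
      merge : count ((P? ─? os) -? o) xs ≡ count (P? ─? (o ∷ os)) xs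
      merge = count-cong ((P? ─? os) -? o) (P? ─? (o ∷ os)) {xs} (All.tabulate λ _ → ─∷⇔)

module Orbits where

  open Arithmetic using (LeastPositive)
  open Counting
  open import Data.Empty
  open import Data.Fin using (Fin; toℕ; fromℕ<)
  open import Data.Fin.Properties using (toℕ-injective; toℕ<n; toℕ-fromℕ<)
  open import Data.List using (List; []; _∷_; length; tabulate)
  open import Data.List.Membership.Propositional using (_∈_; _∉_)
  open import Data.List.Membership.Propositional.Properties using (∈-tabulate⁺; ∈-tabulate⁻)
  open import Data.List.Properties using (length-tabulate)
  open import Data.List.Relation.Unary.All as All using (All; []; _∷_)
  open import Data.List.Relation.Unary.Unique.Propositional using (Unique)
  open import Data.List.Relation.Unary.Unique.Propositional.Properties using (tabulate⁺)
  open import Data.Nat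
  open import Data.Nat.GeneralisedArithmetic using (fold; fold-+)
  open import Data.Nat.Properties
  open import Data.Product
  open import Data.Sum
  open import Function using (_∘_; _⇔_; mk⇔; Equivalence)
  open import Level using (0ℓ)
  open import Relation.Binary.Definitions using (DecidableEquality; tri<; tri≈; tri>)
  open import Relation.Binary.PropositionalEquality
  open import Relation.Nullary
  open import Relation.Unary using (Pred; Decidable)
  open import Relation.Unary.Properties using (_∩?_)

  fold-suc : ∀ {A : Set} (z : A) s k → fold z s (suc k) ≡ fold (s z) s k
  fold-suc z s k = trans (cong (fold z s) (+-comm 1 k)) (fold-+ z s k)

  fold-periodic : ∀ {A : Set} (z : A) s {k} → fold z s k ≡ z → ∀ q → fold z s (q * k) ≡ z
  fold-periodic z s z^k≡z zero    = refl
  fold-periodic z s {k} z^k≡z (suc q) = trans (fold-+ z s k) (trans (cong (λ y → fold y s k) (fold-periodic z s z^k≡z q)) z^k≡z)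

  module OrbitCounting {A : Set} (_≟_ : DecidableEquality A) (σ : A → A) (k′ : ℕ)
                       (σ^k≡id : ∀ a → fold a σ (suc k′) ≡ a) where

    open Removal _≟_

    k : ℕ
    k = suc k′

    σ-injective : ∀ {a b} → σ a ≡ σ b → a ≡ b
    σ-injective {a} {b} σa≡σb = begin
      a                ≡⟨ σ^k≡id a ⟨
      fold a σ k       ≡⟨ fold-suc a σ k′ ⟩
      fold (σ a) σ k′  ≡⟨ cong (λ y → fold y σ k′) σa≡σb ⟩
      fold (σ b) σ k′  ≡⟨ fold-suc b σ k′ ⟨
      fold b σ k       ≡⟨ σ^k≡id b ⟩
      b                ∎
      where open ≡-Reasoning

    σ^j-injective : ∀ j {a b} → fold a σ j ≡ fold b σ j → a ≡ b
    σ^j-injective zero    = λ a≡b → a≡b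
    σ^j-injective (suc j) = σ^j-injective j ∘ σ-injective

    HasPeriod : A → ℕ → Set
    HasPeriod a = LeastPositive (λ j → fold a σ j ≡ a)

    Fixed : Pred A 0ℓ
    Fixed a = σ a ≡ a

    fixed? : Decidable Fixed
    fixed? a = σ a ≟ a

    module Orbit {a : A} (a-unfixed : ¬ Fixed a) (a-period : HasPeriod a k) where

      orbit : List A
      orbit = tabulate {n = k} (λ i → fold a σ (toℕ i))

      ∈-orbit⁺ : ∀ {b} j → j < k → b ≡ fold a σ j → b ∈ orbit
      ∈-orbit⁺ j j<k refl = subst (_∈ orbit) (cong (fold a σ) (toℕ-fromℕ< j<k))
                                  (∈-tabulate⁺ {f = λ i → fold a σ (toℕ i)} (fromℕ< j<k))

      ∈-orbit⁻ : ∀ {b} → b ∈ orbit → ∃ λ j → j < k × b ≡ fold a σ j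
      ∈-orbit⁻ b∈orbit = let i , b≡ = ∈-tabulate⁻ {f = λ i → fold a σ (toℕ i)} b∈orbit in toℕ i , toℕ<n i , b≡

      orbit-unique : Unique orbit
      orbit-unique = tabulate⁺ λ {i} {j} eq → toℕ-injective (injective (toℕ i) (toℕ j) (toℕ<n i) (toℕ<n j) eq)
        where
        distinct : ∀ {i j} → i < j → j < k → fold a σ i ≢ fold a σ j
        distinct {i} {j} i<j j<k σ^ia≡σ^ja = proj₂ (proj₂ a-period) (j ∸ i) (m<n⇒0<n∸m i<j) (≤-<-trans (m∸n≤m j i) j<k)
          (sym (σ^j-injective i (trans σ^ia≡σ^ja (trans (cong (fold a σ) (sym (m+[n∸m]≡n (<⇒≤ i<j)))) (fold-+ a σ i)))))
        injective : ∀ i j → i < k → j < k → fold a σ i ≡ fold a σ j → i ≡ j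
        injective i j i<k j<k eq with <-cmp i j
        ... | tri< i<j _ _ = ⊥-elim (distinct i<j j<k eq)
        ... | tri≈ _ i≡j _ = i≡j
        ... | tri> _ _ j<i = ⊥-elim (distinct j<i i<k (sym eq))

      orbit-length : length orbit ≡ k
      orbit-length = length-tabulate (λ (i : Fin k) → fold a σ (toℕ i))

      σ-∈-orbit : ∀ {b} → σ b ∈ orbit ⇔ b ∈ orbit
      σ-∈-orbit = mk⇔ backward forward
        where
        forward : ∀ {b} → b ∈ orbit → σ b ∈ orbit
        forward b∈orbit with ∈-orbit⁻ b∈orbit
        ... | j , j<k , refl with m≤n⇒m<n∨m≡n j<k
        ...   | inj₁ j+1<k = ∈-orbit⁺ (suc j) j+1<k refl
        ...   | inj₂ refl  = ∈-orbit⁺ 0 z<s (σ^k≡id a)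
        backward : ∀ {b} → σ b ∈ orbit → b ∈ orbit
        backward σb∈orbit with ∈-orbit⁻ σb∈orbit
        ... | zero  , _   , σb≡a   = ∈-orbit⁺ k′ ≤-refl (σ-injective (trans σb≡a (sym (σ^k≡id a))))
        ... | suc j , j<k , σb≡σ^ja = ∈-orbit⁺ j (<-trans (n<1+n j) j<k) (σ-injective σb≡σ^ja)

      orbit-unfixed : ∀ {b} → b ∈ orbit → ¬ Fixed b
      orbit-unfixed b∈orbit σb≡b with ∈-orbit⁻ b∈orbit
      ... | j , _ , refl = a-unfixed (σ^j-injective j (trans (sym (fold-suc a σ j)) σb≡b))

    Invariant : Pred A 0ℓ → Set
    Invariant P = ∀ a → P (σ a) ⇔ P a

    FixedOrFree : Pred A 0ℓ → Set
    FixedOrFree P = ∀ a → P a → ¬ Fixed a → HasPeriod a k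

    invariant-fold : ∀ {P} → Invariant P → ∀ {a} j → P a → P (fold a σ j)
    invariant-fold inv zero    Pa = Pa
    invariant-fold inv (suc j) Pa = Equivalence.from (inv _) (invariant-fold inv j Pa)

    module _ {enum : List A} (enum-unique : Unique enum) (enum-complete : ∀ a → a ∈ enum) where

      private
        ∩⇔ : ∀ {P Q R : Pred A 0ℓ} {b} → ((P b × Q b) × R b) ⇔ ((P b × R b) × Q b)
        ∩⇔ = mk⇔ (λ ((p , q) , r) → (p , r) , q) (λ ((p , r) , q) → (p , q) , r)

      module _ {P : Pred A 0ℓ} (P? : Decidable P) (P-invariant : Invariant P) (P-fixedOrFree : FixedOrFree P) where

        module _ {a} (a-fixed : Fixed a) (Pa : P a) where

          remove-fixed-invariant : Invariant (λ b → P b × b ≢ a)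
          remove-fixed-invariant b = mk⇔
            (λ (Pσb , σb≢a) → Equivalence.to (P-invariant b) Pσb , λ { refl → σb≢a a-fixed })
            (λ (Pb , b≢a) → Equivalence.from (P-invariant b) Pb , λ σb≡a → b≢a (σ-injective (trans σb≡a (sym a-fixed))))

          count-remove-fixed : count P? enum ≡ suc (count (P? -? a) enum)
          count-remove-fixed = count-remove P? enum-unique (enum-complete a) Pa

          count-remove-fixed∩fixed : count (P? ∩? fixed?) enum ≡ suc (count ((P? -? a) ∩? fixed?) enum)
          count-remove-fixed∩fixed = trans (count-remove (P? ∩? fixed?) enum-unique (enum-complete a) (Pa , a-fixed))
            (cong suc (count-cong ((P? ∩? fixed?) -? a) ((P? -? a) ∩? fixed?) {enum}
                                  (All.tabulate λ _ → ∩⇔ {P} {Fixed} {λ b → b ≢ a})))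

        module _ {a} (a-unfixed : ¬ Fixed a) (Pa : P a) where
          open Orbit a-unfixed (P-fixedOrFree a Pa a-unfixed)

          remove-orbit-invariant : Invariant (λ b → P b × b ∉ orbit)
          remove-orbit-invariant b = mk⇔
            (λ (Pσb , σb∉orbit) → Equivalence.to (P-invariant b) Pσb , σb∉orbit ∘ Equivalence.from σ-∈-orbit)
            (λ (Pb , b∉orbit) → Equivalence.from (P-invariant b) Pb , b∉orbit ∘ Equivalence.to σ-∈-orbit)

          count-remove-orbit : count P? enum ≡ k + count (P? ─? orbit) enum
          count-remove-orbit = trans (count-removeAll P? enum-unique orbit⊆enum orbit-unique P-orbit)
                                     (cong (_+ count (P? ─? orbit) enum) orbit-length)
            where
            orbit⊆enum : All (_∈ enum) orbit
            orbit⊆enum = All.tabulate λ {b} _ → enum-complete b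
            P-orbit : All P orbit
            P-orbit = All.tabulate λ b∈orbit →
              let j , _ , b≡ = ∈-orbit⁻ b∈orbit in subst P (sym b≡) (invariant-fold P-invariant j Pa)

          count-remove-orbit∩fixed : count (P? ∩? fixed?) enum ≡ count ((P? ─? orbit) ∩? fixed?) enum
          count-remove-orbit∩fixed = count-cong (P? ∩? fixed?) ((P? ─? orbit) ∩? fixed?) {enum} (All.tabulate λ _ →
            mk⇔ (λ (Pb , Fb) → (Pb , λ b∈orbit → orbit-unfixed b∈orbit Fb) , Fb) (λ ((Pb , _) , Fb) → Pb , Fb))

      -- Induction on count P? enum: remove from P either a fixed point or a whole orbit, of size k.
      orbitCounting : ∀ {P} (P? : Decidable P) → Invariant P → FixedOrFree P →
                      ∃ λ c → count P? enum ≡ count (P? ∩? fixed?) enum + c * k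
      orbitCounting P? = go (count P? enum) P? ≤-refl
        where
        go : ∀ N {P} (P? : Decidable P) → count P? enum ≤ N → Invariant P → FixedOrFree P →
             ∃ λ c → count P? enum ≡ count (P? ∩? fixed?) enum + c * k
        go N P? bound inv free with 0 <? count P? enum
        ... | no count≯0 = 0 , trans count≡0 (sym (trans (+-identityʳ _) (n≤0⇒n≡0 count∩fixed≤0)))
          where
          count≡0 : count P? enum ≡ 0
          count≡0 = n≤0⇒n≡0 (≮⇒≥ count≯0)
          count∩fixed≤0 : count (P? ∩? fixed?) enum ≤ 0
          count∩fixed≤0 = subst (count (P? ∩? fixed?) enum ≤_) count≡0 (count-mono (P? ∩? fixed?) P? proj₁ enum)
        go zero    P? bound inv free | yes count>0 = ⊥-elim (<⇒≱ count>0 bound)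
        go (suc N) P? bound inv free | yes count>0 with count>0⇒∃ P? enum count>0
        ... | a , Pa with fixed? a
        ...   | yes a-fixed = let c , eq = go N (P? -? a) bound′ (remove-fixed-invariant P? inv free a-fixed Pa)
                                             (λ b (Pb , _) → free b Pb) in
                c , (begin
                  count P? enum                                   ≡⟨ count-remove-fixed P? inv free a-fixed Pa ⟩
                  suc (count (P? -? a) enum)                      ≡⟨ cong suc eq ⟩
                  suc (count ((P? -? a) ∩? fixed?) enum + c * k)  ≡⟨ cong (_+ c * k) fixed-removed ⟨
                  count (P? ∩? fixed?) enum + c * k               ∎)
          where
          open ≡-Reasoning
          fixed-removed : count (P? ∩? fixed?) enum ≡ suc (count ((P? -? a) ∩? fixed?) enum)
          fixed-removed = count-remove-fixed∩fixed P? inv free a-fixed Pa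
          bound′ : count (P? -? a) enum ≤ N
          bound′ = ≤-pred (subst (_≤ suc N) (count-remove-fixed P? inv free a-fixed Pa) bound)
        ...   | no a-unfixed = let c , eq = go N (P? ─? orbit) bound′ (remove-orbit-invariant P? inv free a-unfixed Pa)
                                               (λ b (Pb , _) → free b Pb) in
                suc c , (begin
                  count P? enum                                       ≡⟨ count-remove-orbit P? inv free a-unfixed Pa ⟩
                  k + count (P? ─? orbit) enum                        ≡⟨ cong (k +_) eq ⟩
                  k + (count ((P? ─? orbit) ∩? fixed?) enum + c * k)  ≡⟨ cong (λ m → k + (m + c * k)) fixed-unchanged ⟨
                  k + (count (P? ∩? fixed?) enum + c * k)             ≡⟨ +-assoc k _ _ ⟨
                  k + count (P? ∩? fixed?) enum + c * k               ≡⟨ cong (_+ c * k) (+-comm k _) ⟩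
                  count (P? ∩? fixed?) enum + k + c * k               ≡⟨ +-assoc _ k _ ⟩
                  count (P? ∩? fixed?) enum + suc c * k               ∎)
          where
          open ≡-Reasoning
          open Orbit a-unfixed (free a Pa a-unfixed)
          fixed-unchanged : count (P? ∩? fixed?) enum ≡ count ((P? ─? orbit) ∩? fixed?) enum
          fixed-unchanged = count-remove-orbit∩fixed P? inv free a-unfixed Pa
          bound′ : count (P? ─? orbit) enum ≤ N
          bound′ = ≤-trans (m≤n+m _ k′) (≤-pred (subst (_≤ suc N) (count-remove-orbit P? inv free a-unfixed Pa) bound))

module SubsetCounting where

  open Counting using (count)
  open import Data.Fin using (Fin; zero; suc)
  open import Data.Fin.Subset using (Subset; inside; outside; ∣_∣; _∈_)
  open import Data.Fin.Subset.Properties using (drop-there)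
  open import Data.List using (tabulate)
  open import Data.Nat using (suc)
  open import Data.Vec using ([]; _∷_; here; there)
  open import Function using (_∘_; _⇔_; mk⇔; Equivalence; case_of_)
  open import Level using (0ℓ)
  open import Relation.Binary.PropositionalEquality
  open import Relation.Nullary.Decidable using (dec-true; dec-false)
  open import Relation.Unary using (Pred; Decidable)

  ∈-tail⇔ : ∀ {X : Set} {m x} {i : Fin m} {H} → X ⇔ suc i ∈ (x ∷ H) → X ⇔ i ∈ H
  ∈-tail⇔ e = mk⇔ (drop-there ∘ Equivalence.to e) (Equivalence.from e ∘ there)

  count-tabulate : ∀ {A : Set} {P : Pred A 0ℓ} (P? : Decidable P) {m} (f : Fin m → A) (H : Subset m) →
                   (∀ i → P (f i) ⇔ i ∈ H) → count P? (tabulate f) ≡ ∣ H ∣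
  count-tabulate P? f []      _    = refl
  count-tabulate P? f (x ∷ H) Pf⇔H with x
  ... | inside  rewrite dec-true (P? (f zero)) (Equivalence.from (Pf⇔H zero) here) =
    cong suc (count-tabulate P? (f ∘ suc) H (∈-tail⇔ ∘ Pf⇔H ∘ suc))
  ... | outside rewrite dec-false (P? (f zero)) (λ Pf0 → case Equivalence.to (Pf⇔H zero) Pf0 of λ ()) =
    count-tabulate P? (f ∘ suc) H (∈-tail⇔ ∘ Pf⇔H ∘ suc)

module Tuples where

  open Orbits using (fold-suc)
  open import Data.List using (List; []; _∷_; [_]; _++_; length; map; cartesianProductWith)
  open import Data.List.Membership.Propositional using (_∈_)
  open import Data.List.Membership.Propositional.Properties using (∈-cartesianProductWith⁺)
  open import Data.List.Properties using (++-assoc; ++-identityʳ; length-++; length-map; ∷-injective)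
  open import Data.List.Relation.Unary.All using ([])
  open import Data.List.Relation.Unary.Any using (here)
  open import Data.List.Relation.Unary.Unique.Propositional using (Unique; []; _∷_)
  open import Data.List.Relation.Unary.Unique.Propositional.Properties using (cartesianProductWith⁺)
  open import Data.Nat hiding (_≟_)
  open import Data.Nat.GeneralisedArithmetic using (fold)
  open import Data.Product using (_×_; _,_)
  open import Data.Vec as Vec using (Vec)
  import Data.Vec.Properties as Vec
  open import Relation.Binary.PropositionalEquality hiding ([_])

  module _ {A : Set} where

    rotate : List A → List A
    rotate []       = []
    rotate (x ∷ xs) = xs ++ [ x ]

    rotate^length-++ : ∀ xs ys → fold (xs ++ ys) rotate (length xs) ≡ ys ++ xs
    rotate^length-++ []       ys = sym (++-identityʳ ys)
    rotate^length-++ (x ∷ xs) ys = begin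
      fold (x ∷ xs ++ ys) rotate (suc (length xs))  ≡⟨ fold-suc (x ∷ xs ++ ys) rotate (length xs) ⟩
      fold ((xs ++ ys) ++ [ x ]) rotate (length xs) ≡⟨ cong (λ zs → fold zs rotate (length xs)) (++-assoc xs ys [ x ]) ⟩
      fold (xs ++ ys ++ [ x ]) rotate (length xs)   ≡⟨ rotate^length-++ xs (ys ++ [ x ]) ⟩
      (ys ++ [ x ]) ++ xs                           ≡⟨ ++-assoc ys [ x ] xs ⟩
      ys ++ x ∷ xs                                  ∎
      where open ≡-Reasoning

    rotate^length : ∀ xs → fold xs rotate (length xs) ≡ xs
    rotate^length xs = trans (cong (λ zs → fold zs rotate (length xs)) (sym (++-identityʳ xs))) (rotate^length-++ xs [])

    vecsOf : List A → ∀ m → List (Vec A m)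
    vecsOf xs zero    = [ Vec.[] ]
    vecsOf xs (suc m) = cartesianProductWith Vec._∷_ xs (vecsOf xs m)

    vecsOf-unique : ∀ {xs} → Unique xs → ∀ m → Unique (vecsOf xs m)
    vecsOf-unique xs! zero    = [] ∷ []
    vecsOf-unique xs! (suc m) = cartesianProductWith⁺ Vec._∷_ Vec.∷-injective xs! (vecsOf-unique xs! m)

    vecsOf-complete : ∀ {xs} → (∀ a → a ∈ xs) → ∀ {m} (v : Vec A m) → v ∈ vecsOf xs m
    vecsOf-complete complete Vec.[]       = here refl
    vecsOf-complete complete (x Vec.∷ v) = ∈-cartesianProductWith⁺ Vec._∷_ (complete x) (vecsOf-complete complete v)

    length-vecsOf : ∀ xs m → length (vecsOf xs m) ≡ length xs ^ m
    length-vecsOf xs zero    = refl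
    length-vecsOf xs (suc m) = trans (length-cartesianProductWith Vec._∷_ xs (vecsOf xs m)) (cong (length xs *_) (length-vecsOf xs m))
      where
      length-cartesianProductWith : ∀ {B C : Set} (f : A → B → C) xs ys →
                                    length (cartesianProductWith f xs ys) ≡ length xs * length ys
      length-cartesianProductWith f []       ys = refl
      length-cartesianProductWith f (x ∷ xs) ys = trans (length-++ (map (f x) ys))
        (cong₂ _+_ (length-map (f x) ys) (length-cartesianProductWith f xs ys))

    ∷ʳ≡∷⇒replicate : ∀ {k} x (xs : Vec A k) c → xs Vec.∷ʳ c ≡ x Vec.∷ xs → xs ≡ Vec.replicate k x × c ≡ x
    ∷ʳ≡∷⇒replicate x Vec.[]       c eq = refl , Vec.∷-injectiveˡ eq
    ∷ʳ≡∷⇒replicate x (y Vec.∷ ys) c eq with Vec.∷-injective eq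
    ... | refl , eq′ with ∷ʳ≡∷⇒replicate y ys c eq′
    ...   | ys≡ , c≡ = cong (y Vec.∷_) ys≡ , c≡

    replicate-∷ʳ : ∀ k (x : A) → Vec.replicate k x Vec.∷ʳ x ≡ x Vec.∷ Vec.replicate k x
    replicate-∷ʳ zero    x = refl
    replicate-∷ʳ (suc k) x = cong (x Vec.∷_) (replicate-∷ʳ k x)

    toList-injective : ∀ {k} (u v : Vec A k) → Vec.toList u ≡ Vec.toList v → u ≡ v
    toList-injective Vec.[]       Vec.[]       _  = refl
    toList-injective (x Vec.∷ u) (y Vec.∷ v) eq with ∷-injective eq
    ... | refl , eq′ = cong (x Vec.∷_) (toList-injective u v eq′)

module GroupTheory (G : FinGroup) where

  open Arithmetic
  open Counting
  open Orbits
  open SubsetCounting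
  open Tuples
  open import Algebra.Bundles using (Group)
  open import Data.Empty
  open import Data.Fin using (Fin; toℕ; fromℕ<) renaming (_≟_ to _≟ᶠ_)
  open import Data.Fin.Properties using (pigeonhole; any?; ¬∀⟶∃¬; nonZeroIndex; toℕ-fromℕ<)
  open import Data.Fin.Subset using (_∈_; ∣_∣; ⁅_⁆)
  open import Data.Fin.Subset.Properties using (_∈?_; p⊆q⇒∣p∣≤∣q∣; x∈⁅x⁆; ∣⁅x⁆∣≡1)
  open import Data.List using (List; allFin; [_]; _++_; length; filter)
  open import Data.List.Extrema.Nat using (argmax; argmax-all; f[xs]≤f[argmax])
  open import Data.List.Membership.Propositional using () renaming (_∈_ to _∈ₗ_)
  open import Data.List.Membership.Propositional.Properties using (∈-allFin; ∈-filter⁺)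
  open import Data.List.Properties using (length-++; ∷ʳ-injectiveˡ; length-tabulate)
  import Data.List.Relation.Unary.All as All
  open import Data.List.Relation.Unary.All.Properties using (all-filter)
  open import Data.List.Relation.Unary.Unique.Propositional using (Unique)
  open import Data.List.Relation.Unary.Unique.Propositional.Properties using (allFin⁺)
  open import Data.Nat
  open import Data.Nat.DivMod
  open import Data.Nat.Divisibility
  open import Data.Nat.GeneralisedArithmetic using (fold; fold-+)
  open import Data.Nat.Primality
  open import Data.Nat.Properties
  open import Data.Product
  open import Data.Sum
  open import Data.Vec as Vec using (Vec)
  import Data.Vec.Properties as Vec
  open import Function using (_∘_; id; const; mk⇔)
  open import Level using (0ℓ)
  open import Relation.Binary.Definitions using (DecidableEquality)
  open import Relation.Binary.PropositionalEquality hiding ([_])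
  open import Relation.Nullary
  open import Relation.Nullary.Decidable using (¬?; _×-dec_; _→-dec_; map′)
  open import Relation.Unary using (U)
  open import Relation.Unary.Properties using (_∩?_; U?)

  open FinGroup G

  group : Group 0ℓ 0ℓ
  group = record { _≈_ = _≡_ ; _∙_ = _∙_ ; ε = ε ; _⁻¹ = _⁻¹ ; isGroup = isGroup }

  open Group group using (assoc; identityˡ; identityʳ; inverseˡ; inverseʳ)
  open import Algebra.Properties.Group group using (∙-cancelˡ; identityˡ-unique; inverseˡ-unique; ε⁻¹≈ε)

  pow-+ : ∀ x i j → pow x (i + j) ≡ pow x i ∙ pow x j
  pow-+ x zero    j = sym (identityˡ _)
  pow-+ x (suc i) j = trans (cong (x ∙_) (pow-+ x i j)) (sym (assoc _ _ _))

  pow-* : ∀ x i j → pow x (i * j) ≡ pow (pow x j) i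
  pow-* x zero    j = refl
  pow-* x (suc i) j = trans (pow-+ x j (i * j)) (cong (pow x j ∙_) (pow-* x i j))

  pow-1 : ∀ x → pow x 1 ≡ x
  pow-1 = identityʳ

  pow-2 : ∀ x → pow x 2 ≡ x ∙ x
  pow-2 x = cong (x ∙_) (identityʳ x)

  pow-ε : ∀ k → pow ε k ≡ ε
  pow-ε zero    = refl
  pow-ε (suc k) = trans (identityˡ _) (pow-ε k)

  pow-comm : ∀ x i j → pow x i ∙ pow x j ≡ pow x j ∙ pow x i
  pow-comm x i j = trans (sym (pow-+ x i j)) (trans (cong (pow x) (+-comm i j)) (pow-+ x j i))

  comm-pow : ∀ {x y} → x ∙ y ≡ y ∙ x → ∀ k → x ∙ pow y k ≡ pow y k ∙ x
  comm-pow {x} {y} xy≡yx zero    = trans (identityʳ x) (sym (identityˡ x))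
  comm-pow {x} {y} xy≡yx (suc k) = begin
    x ∙ (y ∙ pow y k)   ≡⟨ assoc x y _ ⟨
    (x ∙ y) ∙ pow y k   ≡⟨ cong (_∙ pow y k) xy≡yx ⟩
    (y ∙ x) ∙ pow y k   ≡⟨ assoc y x _ ⟩
    y ∙ (x ∙ pow y k)   ≡⟨ cong (y ∙_) (comm-pow xy≡yx k) ⟩
    y ∙ (pow y k ∙ x)   ≡⟨ assoc y _ x ⟨
    (y ∙ pow y k) ∙ x   ∎
    where open ≡-Reasoning

  pow-∙-comm : ∀ {x y} → x ∙ y ≡ y ∙ x → ∀ k → pow (x ∙ y) k ≡ pow x k ∙ pow y k
  pow-∙-comm {x} {y} xy≡yx zero    = sym (identityˡ ε)
  pow-∙-comm {x} {y} xy≡yx (suc k) = begin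
    (x ∙ y) ∙ pow (x ∙ y) k         ≡⟨ cong ((x ∙ y) ∙_) (pow-∙-comm xy≡yx k) ⟩
    (x ∙ y) ∙ (pow x k ∙ pow y k)   ≡⟨ assoc x y _ ⟩
    x ∙ (y ∙ (pow x k ∙ pow y k))   ≡⟨ cong (x ∙_) (assoc y _ _) ⟨
    x ∙ ((y ∙ pow x k) ∙ pow y k)   ≡⟨ cong (λ t → x ∙ (t ∙ pow y k)) (comm-pow (sym xy≡yx) k) ⟩
    x ∙ ((pow x k ∙ y) ∙ pow y k)   ≡⟨ cong (x ∙_) (assoc _ y _) ⟩
    x ∙ (pow x k ∙ (y ∙ pow y k))   ≡⟨ assoc x _ _ ⟨
    (x ∙ pow x k) ∙ (y ∙ pow y k)   ∎
    where open ≡-Reasoning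

  -- Orders

  -- Adj x y is by definition x ≢ y × HasPrimeOrder (x ∙ y).
  HasPrimeOrder : Fin n → Set
  HasPrimeOrder z = ∃[ p ] (Prime p × HasOrder z p)

  pow-order : ∀ {x k} → HasOrder x k → pow x k ≡ ε
  pow-order (_ , x^k≡ε , _) = x^k≡ε

  order-exists : ∀ x → ∃ (HasOrder x)
  order-exists x with pigeonhole (n<1+n n) (λ (i : Fin (suc n)) → pow x (toℕ i))
  ... | i , j , i<j , x^i≡x^j = leastPositive (λ k → pow x k ≟ᶠ ε) (m<n⇒0<n∸m i<j) x^[j-i]≡ε
    where
    x^[j-i]≡ε : pow x (toℕ j ∸ toℕ i) ≡ ε
    x^[j-i]≡ε = identityˡ-unique _ (pow x (toℕ i)) (begin
      pow x (toℕ j ∸ toℕ i) ∙ pow x (toℕ i) ≡⟨ pow-+ x (toℕ j ∸ toℕ i) (toℕ i) ⟨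
      pow x (toℕ j ∸ toℕ i + toℕ i)         ≡⟨ cong (pow x) (m∸n+n≡m (<⇒≤ i<j)) ⟩
      pow x (toℕ j)                         ≡⟨ x^i≡x^j ⟨
      pow x (toℕ i)                         ∎)
      where open ≡-Reasoning

  ∣⇒pow≡ε : ∀ {x k m} → pow x k ≡ ε → k ∣ m → pow x m ≡ ε
  ∣⇒pow≡ε {x} {k} x^k≡ε (divides q refl) =
    trans (pow-* x q k) (trans (cong (λ t → pow t q) x^k≡ε) (pow-ε q))

  pow-+-multiple : ∀ {x k} → pow x k ≡ ε → ∀ r q → pow x (r + q * k) ≡ pow x r
  pow-+-multiple {x} {k} x^k≡ε r q = begin
    pow x (r + q * k)        ≡⟨ pow-+ x r (q * k) ⟩
    pow x r ∙ pow x (q * k)  ≡⟨ cong (pow x r ∙_) (∣⇒pow≡ε x^k≡ε (n∣m*n q)) ⟩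
    pow x r ∙ ε              ≡⟨ identityʳ _ ⟩
    pow x r                  ∎
    where open ≡-Reasoning

  order-∣ : ∀ {x k m} → HasOrder x k → pow x m ≡ ε → k ∣ m
  order-∣ x∶k = leastPositive-∣ x∶k λ q r x^[r+qk]≡ε → trans (sym (pow-+-multiple (pow-order x∶k) r q)) x^[r+qk]≡ε

  order-unique : ∀ {x k l} → HasOrder x k → HasOrder x l → k ≡ l
  order-unique = leastPositive-unique

  order-ε : HasOrder ε 1
  order-ε = z<s , identityʳ ε , λ { j 0<j (s≤s j≤0) _ → <-irrefl refl (≤-trans 0<j j≤0) }

  order-1⇒≡ε : ∀ {x} → HasOrder x 1 → x ≡ ε
  order-1⇒≡ε {x} x∶1 = trans (sym (pow-1 x)) (pow-order x∶1)

  primeOrder⇒≢ε : ∀ {x p} → Prime p → HasOrder x p → x ≢ ε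
  primeOrder⇒≢ε pp x∶p refl = <-irrefl (order-unique order-ε x∶p) (prime⇒>1 pp)

  order-pow-divisor : ∀ {x} d s → 0 < d → HasOrder x (d * s) → HasOrder (pow x s) d
  order-pow-divisor {x} d s 0<d (0<ds , x^ds≡ε , below) = 0<d , trans (sym (pow-* x d s)) x^ds≡ε , below′
    where
    instance
      s≢0 : NonZero s
      s≢0 = >-nonZero (n≢0⇒n>0 λ { refl → <-irrefl (sym (*-zeroʳ d)) 0<ds })
    below′ : ∀ j → 0 < j → j < d → pow (pow x s) j ≢ ε
    below′ j 0<j j<d x^sj≡ε = below (j * s) (*-monoˡ-< s 0<j) (*-monoˡ-< s j<d) (trans (pow-* x j s) x^sj≡ε)

  ≢ε⇒order>1 : ∀ {x k} → x ≢ ε → HasOrder x k → 1 < k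
  ≢ε⇒order>1 {k = 0}             _   x∶k = ⊥-elim (<-irrefl refl (proj₁ x∶k))
  ≢ε⇒order>1 {k = 1}             x≢ε x∶k = ⊥-elim (x≢ε (order-1⇒≡ε x∶k))
  ≢ε⇒order>1 {k = suc (suc _)}   _   _   = s≤s (s≤s z≤n)

  ∃-primeOrderPower : ∀ {x} → x ≢ ε → ∃₂ λ p t → Prime p × HasOrder (pow x t) p
  ∃-primeOrderPower {x} x≢ε with order-exists x
  ... | k , x∶k with ∃-primeDivisor k (≢ε⇒order>1 x≢ε x∶k)
  ...   | p , pp , divides t k≡tp =
    p , t , pp , order-pow-divisor p t (prime⇒>0 pp) (subst (HasOrder x) (trans k≡tp (*-comm t p)) x∶k)

  order-pow-prime : ∀ {y p} m → Prime p → HasOrder y p → pow y m ≢ ε → HasOrder (pow y m) p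
  order-pow-prime {y} {p} m pp y∶p y^m≢ε = prime⇒>0 pp , y^mp≡ε , below
    where
    y^mp≡ε : pow (pow y m) p ≡ ε
    y^mp≡ε = trans (sym (pow-* y p m)) (∣⇒pow≡ε {k = p} (pow-order y∶p) (m∣m*n m))
    below : ∀ j → 0 < j → j < p → pow (pow y m) j ≢ ε
    below j 0<j j<p y^mj≡ε with euclidsLemma j m pp (order-∣ y∶p (trans (pow-* y j m) y^mj≡ε))
    ... | inj₁ p∣j = <⇒≱ j<p (∣⇒≤ {{>-nonZero 0<j}} p∣j)
    ... | inj₂ p∣m = y^m≢ε (∣⇒pow≡ε (pow-order y∶p) p∣m)

  order-prime : ∀ {y p} → Prime p → y ≢ ε → pow y p ≡ ε → HasOrder y p
  order-prime {y} {p} pp y≢ε y^p≡ε with order-exists y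
  ... | k , y∶k with prime⇒irreducible pp (order-∣ y∶k y^p≡ε)
  ...   | inj₁ refl = ⊥-elim (y≢ε (order-1⇒≡ε y∶k))
  ...   | inj₂ refl = y∶k

  order-2 : ∀ {y} → y ≢ ε → y ∙ y ≡ ε → HasOrder y 2
  order-2 {y} y≢ε yy≡ε = order-prime prime[2] y≢ε (trans (pow-2 y) yy≡ε)

  pow-injective : ∀ {g k i j} → HasOrder g k → i < j → j < k → pow g i ≢ pow g j
  pow-injective {g} {k} {i} {j} (_ , _ , below) i<j j<k g^i≡g^j =
    below (j ∸ i) (m<n⇒0<n∸m i<j) (≤-<-trans (m∸n≤m j i) j<k)
      (identityˡ-unique _ (pow g i) (trans (sym (pow-+ g (j ∸ i) i))
        (trans (cong (pow g) (m∸n+n≡m (<⇒≤ i<j))) (sym g^i≡g^j))))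

  private
    component-order : ∀ {u v p q r} → u ∙ v ≡ v ∙ u → Prime p → Prime q → Prime r → p ≢ q →
                      HasOrder u p → HasOrder v q → HasOrder (u ∙ v) r → p ≡ r
    component-order {u} {v} {p} {q} {r} uv≡vu pp pq pr p≢q u∶p v∶q uv∶r
      with euclidsLemma q r pp (order-∣ u∶p u^qr≡ε)
      where
      u^qr≡ε : pow u (q * r) ≡ ε
      u^qr≡ε = begin
        pow u (q * r)                  ≡⟨ identityʳ _ ⟨
        pow u (q * r) ∙ ε              ≡⟨ cong (pow u (q * r) ∙_) (∣⇒pow≡ε {k = q} (pow-order v∶q) (m∣m*n r)) ⟨
        pow u (q * r) ∙ pow v (q * r)  ≡⟨ pow-∙-comm uv≡vu (q * r) ⟨
        pow (u ∙ v) (q * r)            ≡⟨ ∣⇒pow≡ε {k = r} (pow-order uv∶r) (n∣m*n q) ⟩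
        ε                              ∎
        where open ≡-Reasoning
    ... | inj₁ p∣q = ⊥-elim (p≢q (prime∣prime⇒≡ pp pq p∣q))
    ... | inj₂ p∣r = prime∣prime⇒≡ pp pr p∣r

  commuting⇒¬primeOrder : ∀ {u v p q} → u ∙ v ≡ v ∙ u → Prime p → Prime q → p ≢ q →
                          HasOrder u p → HasOrder v q → ¬ HasPrimeOrder (u ∙ v)
  commuting⇒¬primeOrder {u} {v} {p} {q} uv≡vu pp pq p≢q u∶p v∶q (r , pr , uv∶r) =
    p≢q (trans (component-order uv≡vu pp pq pr p≢q u∶p v∶q uv∶r)
               (sym (component-order (sym uv≡vu) pq pp pr (p≢q ∘ sym) v∶q u∶p vu∶r)))
    where
    vu∶r : HasOrder (v ∙ u) r
    vu∶r = subst (λ t → HasOrder t r) uv≡vu uv∶r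

  -- Induced paths in Γ(G)

  inducedP4 : ∀ {a b c d} → Adj a b → Adj b c → Adj c d → a ≢ c → a ≢ d → b ≢ d →
              ¬ Adj a c → ¬ Adj a d → ¬ Adj b d → InducedP4 a b c d
  inducedP4 ab@(a≢b , _) bc@(b≢c , _) cd@(c≢d , _) a≢c a≢d b≢d ¬ac ¬ad ¬bd =
    (a≢b , a≢c , a≢d , b≢c , b≢d , c≢d) , (ab , bc , cd) , (¬ac , ¬ad , ¬bd)

  ¬primeOrder-ε : ¬ HasPrimeOrder ε
  ¬primeOrder-ε (p , pp , ε∶p) = primeOrder⇒≢ε pp ε∶p refl

  private
    -- The path  y — ε — x — x⁻¹y,  with x⁻¹ written x^(p-1).
    cograph⇒¬commuting-oddPrime : IsCograph → ∀ {x y p q} → x ∙ y ≡ y ∙ x → Prime p → Prime q → p ≢ q → q ≢ 2 →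
                                  HasOrder x p → HasOrder y q → ⊥
    cograph⇒¬commuting-oddPrime cograph {x} {y} {p@(suc p′)} {q} xy≡yx pp pq p≢q q≢2 x∶p y∶q =
      cograph y ε x (x′ ∙ y) (inducedP4 yε εx x[x′y] y≢x y≢x′y ε≢x′y ¬yx ¬y[x′y] ¬ε[x′y])
      where
      x′ : Fin n
      x′ = pow x p′
      x′≢ε : x′ ≢ ε
      x′≢ε = proj₂ (proj₂ x∶p) p′ (≤-pred (prime⇒>1 pp)) ≤-refl
      x′∶p : HasOrder x′ p
      x′∶p = order-pow-prime p′ pp x∶p x′≢ε
      x′y≡yx′ : x′ ∙ y ≡ y ∙ x′
      x′y≡yx′ = sym (comm-pow (sym xy≡yx) p′)
      y²∶q : HasOrder (pow y 2) q
      y²∶q = order-pow-prime 2 pq y∶q λ y²≡ε → q≢2 (prime∣prime⇒≡ pq prime[2] (order-∣ y∶q y²≡ε))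
      x[x′y]≡y : x ∙ (x′ ∙ y) ≡ y
      x[x′y]≡y = trans (sym (assoc x x′ y)) (trans (cong (_∙ y) (pow-order x∶p)) (identityˡ y))
      y≢x : y ≢ x
      y≢x y≡x = p≢q (order-unique x∶p (subst (λ t → HasOrder t q) y≡x y∶q))
      y≢x′y : y ≢ x′ ∙ y
      y≢x′y y≡x′y = x′≢ε (identityˡ-unique x′ y (sym y≡x′y))
      ε≢x′y : ε ≢ x′ ∙ y
      ε≢x′y ε≡x′y = y≢x (sym (trans (sym (identityʳ x)) (trans (cong (x ∙_) ε≡x′y) x[x′y]≡y)))
      yε : Adj y ε
      yε = primeOrder⇒≢ε pq y∶q , q , pq , subst (λ t → HasOrder t q) (sym (identityʳ y)) y∶q
      εx : Adj ε x
      εx = (λ ε≡x → primeOrder⇒≢ε pp x∶p (sym ε≡x)) , p , pp , subst (λ t → HasOrder t p) (sym (identityˡ x)) x∶p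
      x≢x′y : x ≢ x′ ∙ y
      x≢x′y x≡x′y = p≢q (sym (prime∣prime⇒≡ pq pp (order-∣ y∶q y^p≡ε)))
        where
        y≡x² : y ≡ pow x 2
        y≡x² = trans (sym x[x′y]≡y) (trans (cong (x ∙_) (sym x≡x′y)) (sym (pow-2 x)))
        y^p≡ε : pow y p ≡ ε
        y^p≡ε = begin
          pow y p            ≡⟨ cong (λ t → pow t p) y≡x² ⟩
          pow (pow x 2) p    ≡⟨ pow-* x p 2 ⟨
          pow x (p * 2)      ≡⟨ ∣⇒pow≡ε {k = p} (pow-order x∶p) (m∣m*n 2) ⟩
          ε                  ∎
          where open ≡-Reasoning
      x[x′y] : Adj x (x′ ∙ y)
      x[x′y] = x≢x′y , q , pq , subst (λ t → HasOrder t q) (sym x[x′y]≡y) y∶q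
      ¬yx : ¬ Adj y x
      ¬yx (_ , po) = commuting⇒¬primeOrder (sym xy≡yx) pq pp (p≢q ∘ sym) y∶q x∶p po
      ¬y[x′y] : ¬ Adj y (x′ ∙ y)
      ¬y[x′y] (_ , po) = commuting⇒¬primeOrder (comm-pow x′y≡yx′ 2) pp pq p≢q x′∶p y²∶q
        (subst HasPrimeOrder y[x′y]≡x′y² po)
        where
        y[x′y]≡x′y² : y ∙ (x′ ∙ y) ≡ x′ ∙ pow y 2
        y[x′y]≡x′y² = begin
          y ∙ (x′ ∙ y)  ≡⟨ assoc y x′ y ⟨
          (y ∙ x′) ∙ y  ≡⟨ cong (_∙ y) x′y≡yx′ ⟨
          (x′ ∙ y) ∙ y  ≡⟨ assoc x′ y y ⟩
          x′ ∙ (y ∙ y)  ≡⟨ cong (x′ ∙_) (pow-2 y) ⟨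
          x′ ∙ pow y 2  ∎
          where open ≡-Reasoning
      ¬ε[x′y] : ¬ Adj ε (x′ ∙ y)
      ¬ε[x′y] (_ , po) = commuting⇒¬primeOrder x′y≡yx′ pp pq p≢q x′∶p y∶q (subst HasPrimeOrder (identityˡ _) po)

  cograph⇒noncommuting : IsCograph → ∀ {x y p q} → Prime p → Prime q → p ≢ q →
                         HasOrder x p → HasOrder y q → x ∙ y ≢ y ∙ x
  cograph⇒noncommuting cograph {q = q} pp pq p≢q x∶p y∶q xy≡yx with q ≟ 2
  ... | no q≢2  = cograph⇒¬commuting-oddPrime cograph xy≡yx pp pq p≢q q≢2 x∶p y∶q
  ... | yes refl = cograph⇒¬commuting-oddPrime cograph (sym xy≡yx) pq pp (p≢q ∘ sym) p≢q y∶q x∶p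

  private
    module PrimeSquareOrder {g p} (pp : Prime p) (g∶p² : HasOrder g (p * p)) where

      instance
        p≢0 : NonZero p
        p≢0 = prime⇒nonZero pp

      pow-multiple-order : ∀ {m} t → m ≡ t * p → ¬ p ∣ t → HasOrder (pow g m) p
      pow-multiple-order t refl p∤t = subst (λ u → HasOrder u p) (sym (pow-* g t p))
        (order-pow-prime t pp (order-pow-divisor p p (prime⇒>0 pp) g∶p²) λ g^pt≡ε →
          p∤t (*-cancelʳ-∣ p (order-∣ g∶p² (trans (pow-* g t p) g^pt≡ε))))

      pow-nonmultiple-¬primeOrder : ∀ m → ¬ p ∣ m → ¬ HasPrimeOrder (pow g m)
      pow-nonmultiple-¬primeOrder m p∤m (r , pr , g^m∶r) with euclidsLemma r m pp (∣-trans (m∣m*n p) pp∣rm)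
        where
        pp∣rm : p * p ∣ r * m
        pp∣rm = order-∣ g∶p² (trans (pow-* g r m) (pow-order g^m∶r))
      ... | inj₂ p∣m = p∤m p∣m
      ... | inj₁ p∣r with prime∣prime⇒≡ pp pr p∣r
      ...   | refl = p∤m (*-cancelˡ-∣ p (order-∣ g∶p² (trans (pow-* g p m) (pow-order g^m∶r))))

    -- For p = 3 + m the path is  g — g^(p-1) — g^(p+1) — g^(p²-1),  with p² - 1 = 8 + 6m + m².
    oddPrimeSquareOrder⇒P4 : ∀ {g} m → Prime (3 + m) → HasOrder g ((3 + m) * (3 + m)) →
      InducedP4 (pow g 1) (pow g (2 + m)) (pow g (4 + m)) (pow g (8 + 6 * m + m * m))
    oddPrimeSquareOrder⇒P4 {g} m pp g∶p² = inducedP4 ab bc cd a≢c a≢d b≢d ¬ac ¬ad ¬bd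
      where
      open PrimeSquareOrder pp g∶p²
      p e₄ : ℕ
      p = 3 + m
      e₄ = 8 + 6 * m + m * m
      p∤2 : ¬ p ∣ 2
      p∤2 p∣2 = <⇒≱ (s≤s (s≤s (s≤s z≤n))) (∣⇒≤ p∣2)
      ∣k+p⇒∣k : ∀ k → p ∣ k + p → p ∣ k
      ∣k+p⇒∣k k p∣k+p = ∣m+n∣m⇒∣n (subst (p ∣_) (+-comm k p) p∣k+p) ∣-refl
      gg : ∀ i j → pow g i ∙ pow g j ≡ pow g (i + j)
      gg i j = sym (pow-+ g i j)
      <pp : ∀ {i} → i ≤ e₄ → i < p * p
      <pp {i} i≤e₄ = subst (i <_) (1+[8+6m+m²]≡[3+m]*[3+m] m) (s≤s i≤e₄)
      e₃<e₄ : 4 + m < e₄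
      e₃<e₄ = subst (4 + m <_) (sym (8+6m+m²≡[4+m]+[4+5m+m²] m)) (m<m+n (4 + m) z<s)
      e₂<e₄ : 2 + m < e₄
      e₂<e₄ = <-trans (≤-trans (n<1+n _) (n≤1+n _)) e₃<e₄
      ab : Adj (pow g 1) (pow g (2 + m))
      ab = pow-injective g∶p² (s≤s (s≤s z≤n)) (<pp (<⇒≤ e₂<e₄)) ,
           p , pp , subst (λ u → HasOrder u p) (sym (gg 1 (2 + m))) (pow-multiple-order 1 (sym (*-identityˡ p)) (prime∤1 pp))
      bc : Adj (pow g (2 + m)) (pow g (4 + m))
      bc = pow-injective g∶p² (≤-trans (n<1+n _) (n≤1+n _)) (<pp (<⇒≤ e₃<e₄)) ,
           p , pp , subst (λ u → HasOrder u p) (sym (gg (2 + m) (4 + m))) (pow-multiple-order 2 ([2+m]+[4+m]≡2*[3+m] m) p∤2)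
      cd : Adj (pow g (4 + m)) (pow g e₄)
      cd = pow-injective g∶p² e₃<e₄ (<pp ≤-refl) ,
           p , pp , subst (λ u → HasOrder u p) (sym (gg (4 + m) e₄))
                      (pow-multiple-order (4 + m) ([4+m]+[8+6m+m²]≡[4+m]*[3+m] m) (prime∤1 pp ∘ ∣k+p⇒∣k 1))
      a≢c : pow g 1 ≢ pow g (4 + m)
      a≢c = pow-injective g∶p² (s≤s (s≤s z≤n)) (<pp (<⇒≤ e₃<e₄))
      a≢d : pow g 1 ≢ pow g e₄
      a≢d = pow-injective g∶p² (s≤s (s≤s z≤n)) (<pp ≤-refl)
      b≢d : pow g (2 + m) ≢ pow g e₄
      b≢d = pow-injective g∶p² e₂<e₄ (<pp ≤-refl)
      ¬ac : ¬ Adj (pow g 1) (pow g (4 + m))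
      ¬ac (_ , po) = pow-nonmultiple-¬primeOrder (1 + (4 + m)) (p∤2 ∘ ∣k+p⇒∣k 2) (subst HasPrimeOrder (gg 1 (4 + m)) po)
      ¬ad : ¬ Adj (pow g 1) (pow g e₄)
      ¬ad (_ , po) = ¬primeOrder-ε (subst HasPrimeOrder (trans (gg 1 e₄) g^[1+e₄]≡ε) po)
        where
        g^[1+e₄]≡ε : pow g (1 + e₄) ≡ ε
        g^[1+e₄]≡ε = trans (cong (pow g) (1+[8+6m+m²]≡[3+m]*[3+m] m)) (pow-order g∶p²)
      ¬bd : ¬ Adj (pow g (2 + m)) (pow g e₄)
      ¬bd (_ , po) = pow-nonmultiple-¬primeOrder (2 + m + e₄) p∤e₂+e₄ (subst HasPrimeOrder (gg (2 + m) e₄) po)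
        where
        p∤e₂+e₄ : ¬ p ∣ 2 + m + e₄
        p∤e₂+e₄ p∣ = p∤2 (∣m+n∣m⇒∣n (subst (p ∣_) (sym ([2+m]+[8+6m+m²]+2≡[4+m]*[3+m] m)) (n∣m*n (4 + m))) p∣)

  cograph⇒¬oddPrimeSquareOrder : IsCograph → ∀ {g p} → Prime p → p ≢ 2 → ¬ HasOrder g (p * p)
  cograph⇒¬oddPrimeSquareOrder cograph {g} {suc (suc (suc m))} pp p≢2 g∶p² = cograph _ _ _ _ (oddPrimeSquareOrder⇒P4 m pp g∶p²)
  cograph⇒¬oddPrimeSquareOrder cograph {p = 2} pp p≢2 = ⊥-elim (p≢2 refl)
  cograph⇒¬oddPrimeSquareOrder cograph {p = 1} pp = ⊥-elim (<⇒≱ (prime⇒>1 pp) ≤-refl)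
  cograph⇒¬oddPrimeSquareOrder cograph {p = 0} pp = ⊥-elim (<⇒≱ (prime⇒>1 pp) z≤n)

  involution⇒primeOrder : ∀ {x} → x ≢ ε → x ∙ x ≡ ε → HasPrimeOrder x
  involution⇒primeOrder x≢ε xx≡ε = 2 , prime[2] , order-2 x≢ε xx≡ε

  x²≡g⁴⇒¬primeOrder : ∀ {g x} → HasOrder g 8 → x ∙ x ≡ pow g 4 → ¬ HasPrimeOrder x
  x²≡g⁴⇒¬primeOrder {g} {x} g∶8 xx≡g⁴ (r , pr , x∶r) =
    g⁴≢ε (trans (sym xx≡g⁴) (trans (sym (pow-2 x)) (pow-order x∶2)))
    where
    g⁴≢ε : pow g 4 ≢ ε
    g⁴≢ε = proj₂ (proj₂ g∶8) 4 z<s (s≤s (s≤s (s≤s (s≤s (s≤s z≤n)))))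
    x^16≡ε : pow x 16 ≡ ε
    x^16≡ε = begin
      pow x (8 * 2)       ≡⟨ pow-* x 8 2 ⟩
      pow (pow x 2) 8     ≡⟨ cong (λ t → pow t 8) (trans (pow-2 x) xx≡g⁴) ⟩
      pow (pow g 4) 8     ≡⟨ pow-* g 8 4 ⟨
      pow g (8 * 4)       ≡⟨ ∣⇒pow≡ε {k = 8} (pow-order g∶8) (divides 4 refl) ⟩
      ε                   ∎
      where open ≡-Reasoning
    x∶2 : HasOrder x 2
    x∶2 = subst (HasOrder x) (prime∣prime⇒≡ pr prime[2] (prime∣^⇒∣ 4 pr (order-∣ x∶r x^16≡ε))) x∶r

  private
    module CommutingInvolution {g z} (zz≡ε : z ∙ z ≡ ε) (gz≡zg : g ∙ z ≡ z ∙ g) where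

      φ : ℕ → Fin n
      φ i = pow g i

      ψ : ℕ → Fin n
      ψ i = φ i ∙ z

      φφ : ∀ i j → φ i ∙ φ j ≡ φ (i + j)
      φφ i j = sym (pow-+ g i j)

      φψ : ∀ i j → φ i ∙ ψ j ≡ ψ (i + j)
      φψ i j = trans (sym (assoc _ _ _)) (cong (_∙ z) (φφ i j))

      ψφ : ∀ i j → ψ i ∙ φ j ≡ ψ (i + j)
      ψφ i j = trans (assoc _ _ _) (trans (cong (φ i ∙_) (comm-pow (sym gz≡zg) j)) (φψ i j))

      ψψ : ∀ i j → ψ i ∙ ψ j ≡ φ (i + j)
      ψψ i j = begin
        ψ i ∙ (φ j ∙ z)       ≡⟨ assoc _ _ _ ⟨
        (ψ i ∙ φ j) ∙ z       ≡⟨ cong (_∙ z) (ψφ i j) ⟩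
        (φ (i + j) ∙ z) ∙ z   ≡⟨ assoc _ _ _ ⟩
        φ (i + j) ∙ (z ∙ z)   ≡⟨ cong (φ (i + j) ∙_) zz≡ε ⟩
        φ (i + j) ∙ ε         ≡⟨ identityʳ _ ⟩
        φ (i + j)             ∎
        where open ≡-Reasoning

  -- The path  g — g³ — gz — g⁷;  the non-edges square to g⁴ or vanish.
  cograph⇒¬order8×involution : IsCograph → ∀ {g z} → HasOrder g 8 → z ∙ z ≡ ε → g ∙ z ≡ z ∙ g →
                               (∀ i → z ≢ pow g i) → ⊥
  cograph⇒¬order8×involution cograph {g} {z} g∶8 zz≡ε gz≡zg z∉⟨g⟩ =
    cograph _ _ _ _ (inducedP4 ab bc cd a≢c a≢d b≢d ¬ac ¬ad ¬bd)
    where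
    open CommutingInvolution zz≡ε gz≡zg
    g⁸≡ε : φ 8 ≡ ε
    g⁸≡ε = pow-order g∶8
    g⁴≢ε : φ 4 ≢ ε
    g⁴≢ε = proj₂ (proj₂ g∶8) 4 z<s (s≤s (s≤s (s≤s (s≤s (s≤s z≤n)))))
    φ[1+j]≢ψ1 : ∀ j → φ (suc j) ≢ ψ 1
    φ[1+j]≢ψ1 j φ[1+j]≡ψ1 = z∉⟨g⟩ j (sym (∙-cancelˡ (φ 1) (φ j) z (trans (sym (pow-+ g 1 j)) φ[1+j]≡ψ1)))
    ab : Adj (φ 1) (φ 3)
    ab = pow-injective g∶8 (s≤s (s≤s z≤n)) (s≤s (s≤s (s≤s (s≤s z≤n)))) ,
         subst HasPrimeOrder (sym (φφ 1 3)) (involution⇒primeOrder g⁴≢ε (trans (φφ 4 4) g⁸≡ε))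
    bc : Adj (φ 3) (ψ 1)
    bc = φ[1+j]≢ψ1 2 , subst HasPrimeOrder (sym (φψ 3 1)) (involution⇒primeOrder ψ4≢ε (trans (ψψ 4 4) g⁸≡ε))
      where
      ψ4≢ε : ψ 4 ≢ ε
      ψ4≢ε ψ4≡ε = z∉⟨g⟩ 4 (∙-cancelˡ (φ 4) z (φ 4) (trans ψ4≡ε (sym (trans (φφ 4 4) g⁸≡ε))))
    cd : Adj (ψ 1) (φ 7)
    cd = φ[1+j]≢ψ1 6 ∘ sym , subst HasPrimeOrder (sym ψ1φ7≡z) (involution⇒primeOrder (z∉⟨g⟩ 0) zz≡ε)
      where
      ψ1φ7≡z : ψ 1 ∙ φ 7 ≡ z
      ψ1φ7≡z = trans (ψφ 1 7) (trans (cong (_∙ z) g⁸≡ε) (identityˡ z))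
    a≢c : φ 1 ≢ ψ 1
    a≢c = φ[1+j]≢ψ1 0
    a≢d : φ 1 ≢ φ 7
    a≢d = pow-injective g∶8 (s≤s (s≤s z≤n)) ≤-refl
    b≢d : φ 3 ≢ φ 7
    b≢d = pow-injective g∶8 (s≤s (s≤s (s≤s (s≤s z≤n)))) ≤-refl
    ¬ac : ¬ Adj (φ 1) (ψ 1)
    ¬ac (_ , po) = x²≡g⁴⇒¬primeOrder g∶8 (trans (cong₂ _∙_ (φψ 1 1) (φψ 1 1)) (ψψ 2 2)) po
    ¬ad : ¬ Adj (φ 1) (φ 7)
    ¬ad (_ , po) = ¬primeOrder-ε (subst HasPrimeOrder (trans (φφ 1 7) g⁸≡ε) po)
    ¬bd : ¬ Adj (φ 3) (φ 7)
    ¬bd (_ , po) = x²≡g⁴⇒¬primeOrder g∶8 (trans (cong₂ _∙_ (φφ 3 7) (φφ 3 7)) (trans (φφ 10 10) g²⁰≡g⁴)) po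
      where
      g²⁰≡g⁴ : φ 20 ≡ φ 4
      g²⁰≡g⁴ = trans (pow-+ g 4 16) (trans (cong (φ 4 ∙_) (∣⇒pow≡ε {k = 8} g⁸≡ε (divides 2 refl))) (identityʳ _))

  cograph⇒order≡oddPrimeDivisor : IsCograph → ∀ {x k p} → HasOrder x k → Prime p → p ≢ 2 → p ∣ k → k ≡ p
  cograph⇒order≡oddPrimeDivisor cograph {x} {k} {p} x∶k pp p≢2 (divides t k≡tp) with t
  ... | zero = ⊥-elim (<-irrefl (sym k≡tp) (proj₁ x∶k))
  ... | suc zero = trans k≡tp (+-identityʳ p)
  ... | t@(suc (suc _)) with ∃-primeDivisor t (s≤s (s≤s z≤n))
  ...   | s , ps , divides u t≡us with s ≟ p
  ...     | yes refl = ⊥-elim (cograph⇒¬oddPrimeSquareOrder cograph ps p≢2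
                         (order-pow-divisor (s * s) u (*-mono-≤ (prime⇒>0 ps) (prime⇒>0 ps))
                           (subst (HasOrder x) (trans k≡tp (trans (cong (_* s) t≡us) (m*n*n≡n*n*m u s))) x∶k)))
  ...     | no s≢p = ⊥-elim (cograph⇒noncommuting cograph pp ps (s≢p ∘ sym) x^t∶p x^up∶s (pow-comm x t (u * p)))
    where
    x^t∶p : HasOrder (pow x t) p
    x^t∶p = order-pow-divisor p t (prime⇒>0 pp) (subst (HasOrder x) (trans k≡tp (*-comm t p)) x∶k)
    x^up∶s : HasOrder (pow x (u * p)) s
    x^up∶s = order-pow-divisor s (u * p) (prime⇒>0 ps)
               (subst (HasOrder x) (trans k≡tp (trans (cong (_* p) t≡us) (m*n*o≡n*[m*o] u s p))) x∶k)

  cograph⇒primeOr2^m : IsCograph → ∀ {x k} → HasOrder x k → Prime k ⊎ ∃[ m ] k ≡ 2 ^ m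
  cograph⇒primeOr2^m cograph {x} {k} x∶k with p-adicDecomposition (s≤s (s≤s z≤n)) k (proj₁ x∶k)
  ... | a , zero , k≡ , 2∤r = ⊥-elim (2∤r (2 ∣0))
  ... | a , suc zero , k≡ , _ = inj₂ (a , trans k≡ (*-identityʳ (2 ^ a)))
  ... | a , r@(suc (suc _)) , k≡ , 2∤r with ∃-primeDivisor r (s≤s (s≤s z≤n))
  ...   | p , pp , p∣r = inj₁ (subst Prime (sym k≡p) pp)
    where
    k≡p : k ≡ p
    k≡p = cograph⇒order≡oddPrimeDivisor cograph x∶k pp (λ { refl → 2∤r p∣r })
            (subst (p ∣_) (sym k≡) (∣n⇒∣m*n (2 ^ a) p∣r))

  -- Lagrange and Cauchy

  fold-∙ : ∀ h a j → fold a (h ∙_) j ≡ pow h j ∙ a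
  fold-∙ h a zero    = sym (identityˡ a)
  fold-∙ h a (suc j) = trans (cong (h ∙_) (fold-∙ h a j)) (sym (assoc h _ a))

  -- h ∈ H permutes H with all orbits of size ord h: the orbits are the cosets of ⟨h⟩.
  lagrange : ∀ {H} → IsSubgroup H → ∀ {h k} → h ∈ H → HasOrder h k → k ∣ ∣ H ∣
  lagrange {H} _ {k = 1} _ _ = 1∣ _
  lagrange {H} (_ , ∙-closed , ⁻¹-closed) {h} {k@(suc k′@(suc _))} h∈H h∶k =
    let c , count≡ = orbitCounting (allFin⁺ n) ∈-allFin (_∈? H) invariant (λ a _ _ → period a) in
    divides c (begin
      ∣ H ∣                                         ≡⟨ count-tabulate (_∈? H) id H (λ _ → mk⇔ id id) ⟨
      count (_∈? H) (allFin n)                      ≡⟨ count≡ ⟩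
      count ((_∈? H) ∩? fixed?) (allFin n) + c * k  ≡⟨ cong (_+ c * k) no-fixed-points ⟩
      c * k                                         ∎)
    where
    open ≡-Reasoning
    open OrbitCounting _≟ᶠ_ (h ∙_) k′ (λ a → trans (fold-∙ h a k) (trans (cong (_∙ a) (pow-order h∶k)) (identityˡ a)))
      hiding (k)
    invariant : Invariant (_∈ H)
    invariant a = mk⇔ (λ ha∈H → subst (_∈ H) (h⁻¹[ha]≡a a) (∙-closed _ _ (⁻¹-closed h h∈H) ha∈H))
                      (∙-closed h a h∈H)
      where
      h⁻¹[ha]≡a : ∀ a → h ⁻¹ ∙ (h ∙ a) ≡ a
      h⁻¹[ha]≡a a = trans (sym (assoc _ h a)) (trans (cong (_∙ a) (inverseˡ h)) (identityˡ a))
    period : ∀ a → HasPeriod a k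
    period a = leastPositive-⇔ (λ j → mk⇔ (λ h^j≡ε → trans (fold-∙ h a j) (trans (cong (_∙ a) h^j≡ε) (identityˡ a)))
                                          (λ σ^ja≡a → identityˡ-unique _ a (trans (sym (fold-∙ h a j)) σ^ja≡a))) h∶k
    no-fixed-points : count ((_∈? H) ∩? fixed?) (allFin n) ≡ 0
    no-fixed-points = count-none ((_∈? H) ∩? fixed?) (λ a (_ , ha≡a) → h≢ε (identityˡ-unique h a ha≡a)) (allFin n)
      where
      h≢ε : h ≢ ε
      h≢ε refl = <-irrefl (sym (order-unique h∶k order-ε)) (s≤s (s≤s z≤n))

  prod : ∀ {k} → Vec (Fin n) k → Fin n
  prod = Vec.foldr _ _∙_ ε

  prod-∷ʳ : ∀ {k} (xs : Vec (Fin n) k) c → prod (xs Vec.∷ʳ c) ≡ prod xs ∙ c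
  prod-∷ʳ Vec.[]       c = trans (identityʳ c) (sym (identityˡ c))
  prod-∷ʳ (x Vec.∷ xs) c = trans (cong (x ∙_) (prod-∷ʳ xs c)) (sym (assoc _ _ _))

  prod-replicate : ∀ k x → prod (Vec.replicate k x) ≡ pow x k
  prod-replicate zero    x = refl
  prod-replicate (suc k) x = cong (x ∙_) (prod-replicate k x)

  -- McKay's proof: σ cycles the entries of the q-tuple (x₁,…,x_{q-1},(x₁⋯x_{q-1})⁻¹), whose product
  -- is ε, so σ^q = id; its fixed points are the constant tuples, i.e. the solutions of x^q = ε.
  module McKay (m : ℕ) where

    q : ℕ
    q = suc (suc m)

    Tuple : Set
    Tuple = Vec (Fin n) (suc m)

    _≟ᵗ_ : DecidableEquality Tuple
    _≟ᵗ_ = Vec.≡-dec _≟ᶠ_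

    σ : Tuple → Tuple
    σ (x Vec.∷ xs) = xs Vec.∷ʳ (x ∙ prod xs) ⁻¹

    closure : Tuple → List (Fin n)
    closure v = Vec.toList v ++ [ prod v ⁻¹ ]

    closure-σ : ∀ v → closure (σ v) ≡ rotate (closure v)
    closure-σ (x Vec.∷ xs) = cong₂ (λ ys y → ys ++ [ y ]) (Vec.toList-∷ʳ c xs) closing
      where
      c : Fin n
      c = (x ∙ prod xs) ⁻¹
      closing : prod (xs Vec.∷ʳ c) ⁻¹ ≡ x
      closing = sym (inverseˡ-unique x _ (begin
        x ∙ prod (xs Vec.∷ʳ c)   ≡⟨ cong (x ∙_) (prod-∷ʳ xs c) ⟩
        x ∙ (prod xs ∙ c)        ≡⟨ assoc x _ c ⟨
        (x ∙ prod xs) ∙ c        ≡⟨ inverseʳ _ ⟩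
        ε                        ∎))
        where open ≡-Reasoning

    closure-σ^ : ∀ j v → closure (fold v σ j) ≡ fold (closure v) rotate j
    closure-σ^ zero    v = refl
    closure-σ^ (suc j) v = trans (closure-σ (fold v σ j)) (cong rotate (closure-σ^ j v))

    closure-injective : ∀ {u v} → closure u ≡ closure v → u ≡ v
    closure-injective {u} {v} eq = toList-injective u v (∷ʳ-injectiveˡ (Vec.toList u) (Vec.toList v) eq)

    σ^q≡id : ∀ v → fold v σ q ≡ v
    σ^q≡id v = closure-injective (begin
      closure (fold v σ q)               ≡⟨ closure-σ^ q v ⟩
      fold (closure v) rotate q          ≡⟨ cong (fold (closure v) rotate) length-closure ⟨
      fold (closure v) rotate (length (closure v)) ≡⟨ rotate^length (closure v) ⟩
      closure v                          ∎)
      where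
      open ≡-Reasoning
      length-closure : length (closure v) ≡ q
      length-closure = trans (length-++ (Vec.toList v)) (trans (cong (_+ 1) (Vec.length-toList v)) (+-comm (suc m) 1))

    open OrbitCounting _≟ᵗ_ σ (suc m) σ^q≡id public
      using (HasPeriod; Fixed; fixed?; orbitCounting)

    period : Prime q → ∀ v → ¬ Fixed v → HasPeriod v q
    period pq v v-unfixed with leastPositive (λ j → fold v σ j ≟ᵗ v) {q} z<s (σ^q≡id v)
    ... | d , v-period with prime⇒irreducible pq (leastPositive-∣ v-period cancel-multiple (σ^q≡id v))
      where
      cancel-multiple : ∀ t r → fold v σ (r + t * d) ≡ v → fold v σ r ≡ v
      cancel-multiple t r σ^[r+td]v≡v = trans (cong (λ w → fold w σ r) (sym (fold-periodic v σ (proj₁ (proj₂ v-period)) t)))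
                                          (trans (sym (fold-+ v σ r)) σ^[r+td]v≡v)
    ...   | inj₁ refl = ⊥-elim (v-unfixed (proj₁ (proj₂ v-period)))
    ...   | inj₂ refl = v-period

    open Removal _≟ᵗ_ using (count-remove; _-?_)

    tuples : List Tuple
    tuples = vecsOf (allFin n) (suc m)

    tuples-unique : Unique tuples
    tuples-unique = vecsOf-unique (allFin⁺ n) (suc m)

    tuples-complete : ∀ v → v ∈ₗ tuples
    tuples-complete = vecsOf-complete ∈-allFin

    module _ (no-solution : ∀ x → x ≢ ε → pow x q ≢ ε) where

      trivial : Tuple
      trivial = Vec.replicate (suc m) ε

      fixed⇒trivial : ∀ v → Fixed v → v ≡ trivial
      fixed⇒trivial (x Vec.∷ xs) σv≡v with ∷ʳ≡∷⇒replicate x xs _ σv≡v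
      ... | refl , prod⁻¹≡x with x ≟ᶠ ε
      ...   | yes refl = refl
      ...   | no x≢ε   = ⊥-elim (no-solution x x≢ε (begin
        x ∙ (x ∙ pow x m)                  ≡⟨ cong (λ t → x ∙ (x ∙ t)) (prod-replicate m x) ⟨
        x ∙ prod (x Vec.∷ Vec.replicate m x)  ≡⟨ cong (_∙ _) prod⁻¹≡x ⟨
        prod (x Vec.∷ Vec.replicate m x) ⁻¹ ∙ prod (x Vec.∷ Vec.replicate m x) ≡⟨ inverseˡ _ ⟩
        ε                                  ∎))
        where open ≡-Reasoning

      trivial-fixed : Fixed trivial
      trivial-fixed = trans (cong (λ c → Vec.replicate m ε Vec.∷ʳ c) ε∙ε⁻¹≡ε) (replicate-∷ʳ m ε)
        where
        ε∙ε⁻¹≡ε : (ε ∙ prod (Vec.replicate m ε)) ⁻¹ ≡ ε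
        ε∙ε⁻¹≡ε = trans (cong _⁻¹ (trans (identityˡ _) (trans (prod-replicate m ε) (pow-ε m)))) ε⁻¹≈ε

      count-fixed : count (U? ∩? fixed?) tuples ≡ 1
      count-fixed = trans (count-remove (U? ∩? fixed?) tuples-unique (tuples-complete trivial) (_ , trivial-fixed))
                          (cong suc (count-none ((U? ∩? fixed?) -? trivial) only-trivial tuples))
        where
        only-trivial : ∀ v → ¬ ((U v × Fixed v) × v ≢ trivial)
        only-trivial v ((_ , v-fixed) , v≢trivial) = v≢trivial (fixed⇒trivial v v-fixed)

  cauchy : ∀ {q} → Prime q → q ∣ n → ∃ λ x → HasOrder x q
  cauchy {0} pq = ⊥-elim (<⇒≱ (prime⇒>1 pq) z≤n)
  cauchy {1} pq = ⊥-elim (<⇒≱ (prime⇒>1 pq) ≤-refl)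
  cauchy {q@(suc (suc m))} pq q∣n with any? (λ x → ¬? (x ≟ᶠ ε) ×-dec (pow x q ≟ᶠ ε))
  ... | yes (x , x≢ε , x^q≡ε) = x , order-prime pq x≢ε x^q≡ε
  ... | no ∄x = let c , n^[m+1]≡cq+1 = n^[m+1]≡1-mod-q in
    ⊥-elim (prime∤1 pq (∣m+n∣m⇒∣n (subst (q ∣_) n^[m+1]≡cq+1 (∣m⇒∣m*n (n ^ m) q∣n)) (n∣m*n c)))
    where
    open McKay m hiding (q)
    no-solution : ∀ x → x ≢ ε → pow x q ≢ ε
    no-solution x x≢ε x^q≡ε = ∄x (x , x≢ε , x^q≡ε)
    n^[m+1]≡1-mod-q : ∃ λ c → n ^ suc m ≡ c * q + 1
    n^[m+1]≡1-mod-q = let c , count≡ = orbitCounting tuples-unique tuples-complete U? (λ _ → mk⇔ id id) (λ v _ → period pq v) in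
      c , (begin
      n ^ suc m                                          ≡⟨ cong (_^ suc m) (length-tabulate {n = n} id) ⟨
      length (allFin n) ^ suc m                          ≡⟨ length-vecsOf (allFin n) (suc m) ⟨
      length tuples                                      ≡⟨ count-all U? _ tuples ⟨
      count U? tuples                                    ≡⟨ count≡ ⟩
      count (U? ∩? fixed?) tuples + c * q                ≡⟨ cong (_+ c * q) (count-fixed no-solution) ⟩
      1 + c * q                                          ≡⟨ +-comm 1 (c * q) ⟩
      c * q + 1                                          ∎)
      where open ≡-Reasoning

  -- Subgroups

  pow-closed : ∀ {H} → IsSubgroup H → ∀ {x} → x ∈ H → ∀ k → pow x k ∈ H
  pow-closed (ε∈H , _ , _)              x∈H zero    = ε∈H
  pow-closed sH@(_ , ∙-closed , _) x∈H (suc k) = ∙-closed _ _ x∈H (pow-closed sH x∈H k)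

  ∃-counterexample : ∀ {H} {P : Fin n → Set} → (∀ x → Dec (P x)) → ¬ (∀ x → x ∈ H → P x) →
                     ∃ λ x → x ∈ H × ¬ P x
  ∃-counterexample {H} P? ¬∀ with ¬∀⟶∃¬ n _ (λ x → x ∈? H →-dec P? x) ¬∀
  ... | x , ¬[x∈H→Px] with x ∈? H
  ...   | yes x∈H = x , x∈H , ¬[x∈H→Px] ∘ const
  ...   | no x∉H  = ⊥-elim (¬[x∈H→Px] (⊥-elim ∘ x∉H))

  ∃-nontrivial : ∀ {H} → 1 < ∣ H ∣ → ∃ λ h → h ∈ H × h ≢ ε
  ∃-nontrivial {H} 1<|H| = ∃-counterexample (λ h → h ≟ᶠ ε) λ all≡ε →
    <⇒≱ 1<|H| (≤-trans (p⊆q⇒∣p∣≤∣q∣ λ h∈H → subst (_∈ ⁅ ε ⁆) (sym (all≡ε _ h∈H)) (x∈⁅x⁆ ε))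
                       (≤-reflexive (∣⁅x⁆∣≡1 ε)))

  order-in-p-subgroup : ∀ {H p a} → IsSubgroup H → Prime p → ∣ H ∣ ≡ p ^ a →
                        ∀ {h k} → h ∈ H → HasOrder h k → ∃ λ b → k ≡ p ^ b
  order-in-p-subgroup {a = a} sH pp |H|≡p^a h∈H h∶k = ∣p^a⇒≡p^b a pp (subst (_ ∣_) |H|≡p^a (lagrange sH h∈H h∶k))

  ∃-maxOrder : ∀ {H} → IsSubgroup H →
               ∃₂ λ g K → g ∈ H × HasOrder g K × (∀ {h k} → h ∈ H → HasOrder h k → k ≤ K)
  ∃-maxOrder {H} (ε∈H , _) = g , ord g , g∈H , x∶ord g , maximal
    where
    ord : Fin n → ℕ
    ord x = proj₁ (order-exists x)
    x∶ord : ∀ x → HasOrder x (ord x)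
    x∶ord x = proj₂ (order-exists x)
    elements : List (Fin n)
    elements = filter (_∈? H) (allFin n)
    g : Fin n
    g = argmax ord ε elements
    g∈H : g ∈ H
    g∈H = argmax-all ord ε∈H (all-filter (_∈? H) (allFin n))
    maximal : ∀ {h k} → h ∈ H → HasOrder h k → k ≤ ord g
    maximal {h} h∈H h∶k = subst (_≤ ord g) (order-unique (x∶ord h) h∶k)
      (All.lookup (f[xs]≤f[argmax] ε elements) (∈-filter⁺ (_∈? H) (∈-allFin h) h∈H))

  cograph⇒order-in-odd-p-subgroup : IsCograph → ∀ {H p a} → IsSubgroup H → Prime p → p ≢ 2 → ∣ H ∣ ≡ p ^ a →
                                     ∀ {h} → h ∈ H → h ≢ ε → HasOrder h p
  cograph⇒order-in-odd-p-subgroup cograph {p = p} {a} sH pp p≢2 |H|≡p^a {h} h∈H h≢ε with order-exists h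
  ... | k , h∶k with order-in-p-subgroup {a = a} sH pp |H|≡p^a h∈H h∶k
  ...   | zero  , refl = ⊥-elim (h≢ε (order-1⇒≡ε h∶k))
  ...   | suc b , refl = subst (HasOrder h) (cograph⇒order≡oddPrimeDivisor cograph h∶k pp p≢2 (m∣m*n (p ^ b))) h∶k

  cograph⇒sylow-exponent : IsCograph → ∀ p → Prime p → p ≢ 2 → p ∣ order → ∀ H → IsSylow p H → HasExponent H p
  cograph⇒sylow-exponent cograph p pp p≢2 p∣n H (sH , a , |H|≡p^a , _ , p^[a+1]∤n) = prime⇒>0 pp , h^p≡ε , minimal
    where
    order-p : ∀ {h} → h ∈ H → h ≢ ε → HasOrder h p
    order-p = cograph⇒order-in-odd-p-subgroup cograph {a = a} sH pp p≢2 |H|≡p^a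
    h^p≡ε : ∀ h → h ∈ H → pow h p ≡ ε
    h^p≡ε h h∈H with h ≟ᶠ ε
    ... | yes refl = pow-ε p
    ... | no h≢ε   = pow-order (order-p h∈H h≢ε)
    1<p^a : ∀ a → ¬ p ^ suc a ∣ n → 1 < p ^ a
    1<p^a zero    p∤n = ⊥-elim (p∤n (subst (_∣ n) (sym (*-identityʳ p)) p∣n))
    1<p^a (suc a) _   = <-≤-trans (prime⇒>1 pp) (m≤m*n p (p ^ a) {{m^n≢0 p a {{prime⇒nonZero pp}}}})
    1<|H| : 1 < ∣ H ∣
    1<|H| = subst (1 <_) (sym |H|≡p^a) (1<p^a a p^[a+1]∤n)
    minimal : ∀ j → 0 < j → j < p → ¬ (∀ h → h ∈ H → pow h j ≡ ε)
    minimal j 0<j j<p all-h^j≡ε with ∃-nontrivial 1<|H|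
    ... | h , h∈H , h≢ε = proj₂ (proj₂ (order-p h∈H h≢ε)) j 0<j j<p (all-h^j≡ε h h∈H)

  cograph⇒trivialCenter : IsCograph → ¬ IsPrimePowerGroup → TrivialCenter
  cograph⇒trivialCenter cograph not-p-group z z-central with z ≟ᶠ ε
  ... | yes z≡ε = z≡ε
  ... | no z≢ε =
    let p , t , pp , z^t∶p = ∃-primeOrderPower z≢ε
        s , ps , s≢p , s∣n = ∃-otherPrimeDivisor pp (>-nonZero⁻¹ n {{nonZeroIndex ε}})
                                                 (λ a n≡p^a → not-p-group (p , pp , a , n≡p^a))
        y , y∶s = cauchy ps s∣n
    in ⊥-elim (cograph⇒noncommuting cograph pp ps (s≢p ∘ sym) z^t∶p y∶s (sym (comm-pow (sym (z-central y)) t)))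

  -- Abelian 2-subgroups

  _∈⟨_⟩ : Fin n → Fin n → Set
  y ∈⟨ g ⟩ = ∃[ j ] y ≡ pow g j

  ∈⟨⟩? : ∀ {g K} → HasOrder g K → ∀ y → Dec (y ∈⟨ g ⟩)
  ∈⟨⟩? {g} {K} g∶K y =
    map′ (λ (i , y≡g^i) → toℕ i , y≡g^i) reduce-exponent (any? λ (i : Fin K) → y ≟ᶠ pow g (toℕ i))
    where
    instance
      K≢0 : NonZero K
      K≢0 = >-nonZero (proj₁ g∶K)
    reduce-exponent : y ∈⟨ g ⟩ → ∃ λ (i : Fin K) → y ≡ pow g (toℕ i)
    reduce-exponent (j , y≡g^j) = fromℕ< (m%n<n j K) , (begin
      y                             ≡⟨ y≡g^j ⟩
      pow g j                       ≡⟨ cong (pow g) (m≡m%n+[m/n]*n j K) ⟩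
      pow g (j % K + j / K * K)     ≡⟨ pow-+-multiple (pow-order g∶K) (j % K) (j / K) ⟩
      pow g (j % K)                 ≡⟨ cong (pow g) (toℕ-fromℕ< (m%n<n j K)) ⟨
      pow g (toℕ (fromℕ< (m%n<n j K))) ∎)
      where open ≡-Reasoning

  module AbelianTwoSubgroup (cograph : IsCograph) {H a} (sH : IsSubgroup H) (|H|≡2^a : ∣ H ∣ ≡ 2 ^ a)
                            (abelian : IsAbelian H) where

    order-2^ : ∀ {h k} → h ∈ H → HasOrder h k → ∃ λ s → k ≡ 2 ^ s
    order-2^ = order-in-p-subgroup {a = a} sH prime[2] |H|≡2^a

    module _ {g K} (g∈H : g ∈ H) (g∶K : HasOrder g K) (K-max : ∀ {h k} → h ∈ H → HasOrder h k → k ≤ K) where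

      order-∣-max : ∀ {h k} → h ∈ H → HasOrder h k → k ∣ K
      order-∣-max h∈H h∶k with order-2^ h∈H h∶k | order-2^ g∈H g∶K
      ... | s , refl | m , refl = p^a≤p^b⇒p^a∣p^b s m (s≤s (s≤s z≤n)) (K-max h∈H h∶k)

      h^K≡ε : ∀ {h} → h ∈ H → pow h K ≡ ε
      h^K≡ε {h} h∈H = let k , h∶k = order-exists h in ∣⇒pow≡ε (pow-order h∶k) (order-∣-max h∈H h∶k)

      -- If w² = gᵗ then t is even, since w^K = g^(tK/2) must vanish; z = w g^(-t/2) squares to ε.
      involution-outside : ∀ {w} h → K ≡ 2 * h → w ∈ H → ¬ w ∈⟨ g ⟩ → pow w 2 ∈⟨ g ⟩ →
                           ∃ λ z → z ∈ H × z ∙ z ≡ ε × ¬ z ∈⟨ g ⟩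
      involution-outside {w} h K≡2h w∈H w∉⟨g⟩ (t , w²≡g^t) with 2 ∣? t
      ... | no 2∤t = ⊥-elim (2∤t (*-cancelʳ-∣ h {{h≢0}} (subst (_∣ t * h) K≡2h (order-∣ g∶K g^th≡ε))))
        where
        h≢0 : NonZero h
        h≢0 = ≢-nonZero λ { refl → <-irrefl (sym K≡2h) (proj₁ g∶K) }
        g^th≡ε : pow g (t * h) ≡ ε
        g^th≡ε = begin
          pow g (t * h)        ≡⟨ cong (pow g) (*-comm t h) ⟩
          pow g (h * t)        ≡⟨ pow-* g h t ⟩
          pow (pow g t) h      ≡⟨ cong (λ x → pow x h) w²≡g^t ⟨
          pow (pow w 2) h      ≡⟨ pow-* w h 2 ⟨
          pow w (h * 2)        ≡⟨ cong (pow w) (trans (*-comm h 2) (sym K≡2h)) ⟩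
          pow w K              ≡⟨ h^K≡ε w∈H ⟩
          ε                    ∎
          where open ≡-Reasoning
      ... | yes (divides u t≡u*2) = w ∙ x , proj₁ (proj₂ sH) w x w∈H x∈H , zz≡ε , z∉⟨g⟩
        where
        instance
          K≢0 : NonZero K
          K≢0 = >-nonZero (proj₁ g∶K)
        e : ℕ
        e = u * pred K
        x : Fin n
        x = pow g e
        x∈H : x ∈ H
        x∈H = pow-closed sH g∈H e
        e+u≡uK : e + u ≡ u * K
        e+u≡uK = trans (+-comm e u) (trans (sym (*-suc u (pred K))) (cong (u *_) (suc-pred K)))
        zz≡ε : (w ∙ x) ∙ (w ∙ x) ≡ ε
        zz≡ε = begin
          (w ∙ x) ∙ (w ∙ x)        ≡⟨ pow-2 (w ∙ x) ⟨
          pow (w ∙ x) 2            ≡⟨ pow-∙-comm (abelian w x w∈H x∈H) 2 ⟩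
          pow w 2 ∙ pow x 2        ≡⟨ cong₂ _∙_ (sym w²≡g^t) (pow-* g 2 e) ⟨
          pow g t ∙ pow g (2 * e)  ≡⟨ pow-+ g t (2 * e) ⟨
          pow g (t + 2 * e)        ≡⟨ cong (λ t → pow g (t + 2 * e)) t≡u*2 ⟩
          pow g (u * 2 + 2 * e)    ≡⟨ cong (pow g) (m*2+2*[m*n]≡2*[m*n+m] u (pred K)) ⟩
          pow g (2 * (e + u))      ≡⟨ cong (λ m → pow g (2 * m)) e+u≡uK ⟩
          pow g (2 * (u * K))      ≡⟨ ∣⇒pow≡ε (pow-order g∶K) (∣n⇒∣m*n 2 (n∣m*n u)) ⟩
          ε                        ∎
          where open ≡-Reasoning
        z∉⟨g⟩ : ¬ (w ∙ x) ∈⟨ g ⟩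
        z∉⟨g⟩ (j , z≡g^j) = w∉⟨g⟩ (j + u , (begin
          w                        ≡⟨ identityʳ w ⟨
          w ∙ ε                    ≡⟨ cong (w ∙_) (∣⇒pow≡ε (pow-order g∶K) (n∣m*n u)) ⟨
          w ∙ pow g (u * K)        ≡⟨ cong (λ m → w ∙ pow g m) e+u≡uK ⟨
          w ∙ pow g (e + u)        ≡⟨ cong (w ∙_) (pow-+ g e u) ⟩
          w ∙ (x ∙ pow g u)        ≡⟨ assoc w x _ ⟨
          (w ∙ x) ∙ pow g u        ≡⟨ cong (_∙ pow g u) z≡g^j ⟩
          pow g j ∙ pow g u        ≡⟨ pow-+ g j u ⟨
          pow g (j + u)            ∎))
          where open ≡-Reasoning

      maxOrder≥8 : ∀ {h₀} → h₀ ∈ H → pow h₀ 4 ≢ ε → ∃ λ m → K ≡ 2 ^ (3 + m)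
      maxOrder≥8 {h₀} h₀∈H h₀^4≢ε with order-exists h₀
      ... | k₀ , h₀∶k₀ with order-2^ h₀∈H h₀∶k₀ | order-2^ g∈H g∶K
      ...   | s , refl | m , refl = from-3≤m (≤-trans 3≤s (p^a≤p^b⇒a≤b s m (s≤s (s≤s z≤n)) (K-max h₀∈H h₀∶k₀)))
        where
        3≤s : 3 ≤ s
        3≤s = ≰⇒> λ s≤2 → h₀^4≢ε (∣⇒pow≡ε (pow-order h₀∶k₀)
                                   (p^a≤p^b⇒p^a∣p^b s 2 (s≤s (s≤s z≤n)) (^-monoʳ-≤ 2 s≤2)))
        from-3≤m : ∀ {m} → 3 ≤ m → ∃ λ m′ → 2 ^ m ≡ 2 ^ (3 + m′)
        from-3≤m {suc (suc (suc m′))} _ = m′ , refl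
        from-3≤m {0} ()
        from-3≤m {1} (s≤s ())
        from-3≤m {2} (s≤s (s≤s ()))

      no-element-outside : ∀ m → K ≡ 2 ^ (3 + m) → ∀ {y} → y ∈ H → ¬ y ∈⟨ g ⟩ → ⊥
      no-element-outside m K≡2^[3+m] {y} y∈H y∉⟨g⟩ = from-upcrossing (upcrossing P? {3 + m} y^1∉⟨g⟩ y^K∈⟨g⟩)
        where
        P : ℕ → Set
        P i = pow y (2 ^ i) ∈⟨ g ⟩
        P? : ∀ i → Dec (P i)
        P? i = ∈⟨⟩? g∶K (pow y (2 ^ i))
        y^1∉⟨g⟩ : ¬ P 0
        y^1∉⟨g⟩ (j , y^1≡g^j) = y∉⟨g⟩ (j , trans (sym (pow-1 y)) y^1≡g^j)
        y^K∈⟨g⟩ : P (3 + m)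
        y^K∈⟨g⟩ = 0 , trans (cong (pow y) (sym K≡2^[3+m])) (h^K≡ε y∈H)
        g′ : Fin n
        g′ = pow g (2 ^ m)
        g′∶8 : HasOrder g′ 8
        g′∶8 = order-pow-divisor 8 (2 ^ m) z<s (subst (HasOrder g) (trans K≡2^[3+m] (2*[2*[2*m]]≡8*m (2 ^ m))) g∶K)
        from-involution : (∃ λ z → z ∈ H × z ∙ z ≡ ε × ¬ z ∈⟨ g ⟩) → ⊥
        from-involution (z , z∈H , zz≡ε , z∉⟨g⟩) =
          cograph⇒¬order8×involution cograph g′∶8 zz≡ε (abelian g′ z (pow-closed sH g∈H (2 ^ m)) z∈H)
            λ i z≡g′^i → z∉⟨g⟩ (i * 2 ^ m , trans z≡g′^i (sym (pow-* g i (2 ^ m))))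
        from-upcrossing : (∃ λ i → ¬ P i × P (suc i)) → ⊥
        from-upcrossing (i , w∉⟨g⟩ , y^[2^[i+1]]∈⟨g⟩) = from-involution
          (involution-outside (2 ^ (2 + m)) K≡2^[3+m] (pow-closed sH y∈H (2 ^ i)) w∉⟨g⟩
            (subst (λ v → v ∈⟨ g ⟩) (pow-* y 2 (2 ^ i)) y^[2^[i+1]]∈⟨g⟩))

  cograph⇒exponent≤4 : IsCograph → ∀ H → IsSylow 2 H → ¬ IsCyclic H → IsAbelian H → ∀ e → HasExponent H e → e ≤ 4
  cograph⇒exponent≤4 cograph H (sH , a , |H|≡2^a , _) non-cyclic abelian e (_ , _ , e-minimal) = ≮⇒≥ λ 4<e →
    let g , K , g∈H , g∶K , K-max = ∃-maxOrder sH
        h₀ , h₀∈H , h₀^4≢ε = ∃-counterexample (λ h → pow h 4 ≟ᶠ ε) (e-minimal 4 z<s 4<e)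
        y , y∈H , y∉⟨g⟩ = ∃-counterexample (∈⟨⟩? g∶K) (λ H⊆⟨g⟩ → non-cyclic (g , g∈H , H⊆⟨g⟩))
        m , K≡2^[3+m] = maxOrder≥8 g∈H g∶K K-max h₀∈H h₀^4≢ε
    in no-element-outside g∈H g∶K K-max m K≡2^[3+m] y∈H y∉⟨g⟩
    where open AbelianTwoSubgroup cograph {a = a} sH |H|≡2^a abelian

mainTheorem14 : (G : FinGroup) → let open FinGroup G in
    IsCograph →
    ((∀ x → x ≢ ε → ∀ k → HasOrder x k → Prime k ⊎ ∃[ m ] k ≡ 2 ^ m)
    × (∀ p → Prime p → p ≢ 2 → p ∣ order → ∀ H → IsSylow p H → HasExponent H p)
    × (∀ H → IsSylow 2 H → ¬ IsCyclic H → IsAbelian H → ∀ e → HasExponent H e → e ≤ 4)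
    × (∀ x y p q → Prime p → Prime q → p ≢ q → HasOrder x p → HasOrder y q → x ∙ y ≢ y ∙ x)
    × (¬ IsPrimePowerGroup → TrivialCenter))
mainTheorem14 G cograph =
    (λ _ _ _ → cograph⇒primeOr2^m cograph)
  , cograph⇒sylow-exponent cograph
  , cograph⇒exponent≤4 cograph
  , (λ _ _ _ _ → cograph⇒noncommuting cograph)
  , cograph⇒trivialCenter cograph
  where open GroupTheory G
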